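{- Let $G$ be a connected graph whose minimum degree is at least $3$. If $A=\{v_1,v_2,\dots,v_m\}$ is an independent set of $G$ such that $G-A$ is connected, then $$\gamma_M(G)\ \ge\ \frac12\sum_{i=1}^m\bigl(d(v_i)-\varepsilon_i\bigr)+\gamma_M(G-\{v_1,\dots,v_m\}),$$ where $d(v_i)$ is the degree of $v_i$ in $G$ and, for each $i$, $\varepsilon_i=1$ if $d(v_i)\equiv 1\pmod 2$ and $\varepsilon_i=2$ otherwise.
   Context: The maximum genus $\gamma_M(H)$ of a connected graph $H$ is the maximum integer $k$ such that $H$ has a (cellular) embedding in the orientable surface of genus $k$. -}

module Defs where

open import Data.Bool using (Bool; true; false; _∧_; not; if_then_else_)
open import Data.Nat using (ℕ; zero; suc; _+_; _*_; _∸_; _≤ᵇ_; _<ᵇ_; _≡ᵇ_; _≤_)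
open import Data.Nat.Base using (_%_)
open import Data.Fin using (Fin; toℕ)
open import Data.List using (List; map; allFin; upTo)
open import Data.Nat.ListAction using (sum)
open import Data.Bool.ListAction using (all)
open import Data.Product using (Σ; _×_; _,_; proj₁; proj₂; ∃)
open import Data.Integer as ℤ using (ℤ; +_)
open import Relation.Binary.PropositionalEquality using (_≡_)

record Graph (n : ℕ) : Set where
  field
    adj    : Fin n → Fin n → Bool
    sym    : ∀ u v → adj u v ≡ adj v u
    irrefl : ∀ v → adj v v ≡ false
open Graph public

Adj : ℕ → Set
Adj n = Fin n → Fin n → Bool

count : {n : ℕ} → (Fin n → Bool) → ℕ
count {n} p = sum (map (λ x → if p x then 1 else 0) (allFin n))

deg : {n : ℕ} → Adj n → Fin n → ℕ
deg a v = count (a v)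

numEdges : {n : ℕ} → Adj n → ℕ
numEdges {n} a = sum (map (λ u → count (λ v → (toℕ u <ᵇ toℕ v) ∧ a u v)) (allFin n))

-- Induced subgraph on the vertices satisfying `keep` (other vertices become
-- isolated placeholders which are NOT counted as vertices; see vertex count).
induced : {n : ℕ} → Adj n → (Fin n → Bool) → Adj n
induced a keep u v = keep u ∧ keep v ∧ a u v

data Reach {n : ℕ} (a : Adj n) : Fin n → Fin n → Set where
  here : ∀ {v} → Reach a v v
  step : ∀ {u w v} → a u w ≡ true → Reach a w v → Reach a u v

Connected : {n : ℕ} → Adj n → (Fin n → Bool) → Set
Connected {n} a keep =
  Σ (Fin n) (λ v → keep v ≡ true) ×
  (∀ u v → keep u ≡ true → keep v ≡ true → Reach a u v)

iter : {A : Set} → (A → A) → ℕ → A → A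
iter f zero x    = x
iter f (suc k) x = f (iter f k x)

-- A rotation system (pure/combinatorial embedding scheme): at each vertex v,
-- a cyclic permutation ρ v of the neighbours of v (values at non-neighbours
-- are irrelevant).
record Rotation {n : ℕ} (a : Adj n) : Set where
  field
    ρ      : Fin n → Fin n → Fin n
    closed : ∀ v u → a v u ≡ true → a v (ρ v u) ≡ true
    inj    : ∀ v u w → a v u ≡ true → a v w ≡ true → ρ v u ≡ ρ v w → u ≡ w
    cyclic : ∀ v u w → a v u ≡ true → a v w ≡ true →
             ∃ (λ k → iter (ρ v) k u ≡ w)
open Rotation public

-- Darts are ordered pairs (u , v) with u adjacent to v.  The face
-- permutation: (u , v) ↦ (v , ρ v u).
facePerm : {n : ℕ} {a : Adj n} → Rotation a → Fin n × Fin n → Fin n × Fin n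
facePerm R (u , v) = (v , ρ R v u)

dartCode : {n : ℕ} → Fin n × Fin n → ℕ
dartCode {n} (u , v) = toℕ u * n + toℕ v

-- A dart is the representative of its face (orbit of facePerm) if its code is
-- minimal among all iterates; orbits have length ≤ n * n.
isFaceRep : {n : ℕ} {a : Adj n} → Rotation a → Fin n × Fin n → Bool
isFaceRep {n} R d =
  all (λ k → dartCode d ≤ᵇ dartCode (iter (facePerm R) k d)) (upTo (n * n))

numFaces : {n : ℕ} {a : Adj n} → Rotation a → ℕ
numFaces {n} {a} R =
  sum (map (λ u → count (λ v → a u v ∧ isFaceRep R (u , v))) (allFin n))

-- Twice the genus of the (cellular, orientable) embedding given by R, via the
-- Euler formula  V - E + F = 2 - 2g,  where V = number of kept vertices.
twiceGenus : {n : ℕ} {a : Adj n} → (Fin n → Bool) → Rotation a → ℤ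
twiceGenus {a = a} keep R =
  + 2 ℤ.- + count keep ℤ.+ + numEdges a ℤ.- + numFaces R

allV : {n : ℕ} → Fin n → Bool
allV _ = true

ε : ℕ → ℕ
ε d = if (d % 2) ≡ᵇ 1 then 1 else 2

sumTerm : {n : ℕ} → Adj n → (Fin n → Bool) → ℕ
sumTerm a inA = sum (map (λ v → if inA v then deg a v ∸ ε (deg a v) else 0) (allFin _))

-- Start from the given embedding of H = G − A and attach the vertices v of A one at a time, edge by edge;
-- all neighbours of v lie in H, and each has a corner in H because H is connected and d(v) ≥ 3. Twice the
-- genus is 2 − V + E − F. The first edge at v is pendant and leaves it unchanged; every later edge joins a
-- corner at its end in H to a chosen corner at v, and either splits a face (no change) or merges two faces
-- (gain 2). Choosing the corner at v greedily yields s merges with d(v) ≤ 2s + 1 or d(v) = 2s + 2, hence a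
-- gain 2s ≥ d(v) − ε(d(v)). Faces are the orbits of the face permutation on darts, and both cases are read
-- off from how adding an edge rewires that permutation.

module Submission where

open import Data.Bool using (Bool; true; false; _∧_; _∨_; not; if_then_else_; T)
open import Data.Bool.Properties
  using (∨-identityʳ; ∨-zeroʳ; ∨-comm; ∨-conicalˡ; ∨-conicalʳ; ∧-zeroʳ; ∧-identityʳ; ∧-comm; ∧-inverseʳ;
         ¬-not; not-¬; ⇔→≡; T-≡)
  renaming (_≟_ to _≟ᵇ_)
open import Data.Bool.ListAction using (all; any; and)
open import Data.Nat using (ℕ; zero; suc; _+_; _*_; _∸_; _≤_; _<_; _≤ᵇ_; _<ᵇ_; _≡ᵇ_; z≤n; s≤s)
open import Data.Nat.Properties
  using (+-0-commutativeMonoid; +-comm; +-identityʳ; +-suc; *-comm; *-suc;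
         ≤-refl; ≤-trans; ≤-reflexive; ≤-antisym; ≤-pred; <⇒≤; <-≤-trans; <-irrefl; <-asym; <-cmp;
         ≤ᵇ⇒≤; ≤⇒≤ᵇ; <⇒<ᵇ; <ᵇ⇒<; ≰⇒>; n<1+n; n≤1+n; m≤n⇒m<n∨m≡n;
         m+[n∸m]≡n; m<n⇒0<n∸m; m∸n≤m; ∸-monoʳ-≤; ∸-monoˡ-≤)
open import Data.Nat.DivMod using (_%_; [m+kn]%n≡m%n)
open import Data.Nat.Induction using (<-wellFounded)
open import Data.Nat.ListAction using (sum)
open import Data.Integer as ℤ using (ℤ; +_; +≤+)
import Data.Integer.Properties as ℤ
open import Data.Integer.Tactic.RingSolver using (solve-∀)
open import Data.Fin using (Fin; zero; suc; toℕ; combine)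
open import Data.Fin.Properties
  using (_≟_; any?; punchInᵢ≢i; toℕ-injective; toℕ<n; toℕ-combine; combine-injectiveˡ; combine-injectiveʳ;
         pigeonhole)
open import Data.List using (allFin; map; tabulate; upTo)
open import Data.List.Properties using (map-tabulate; map-cong)
open import Data.List.Membership.Propositional using (lose)
open import Data.List.Membership.Propositional.Properties using (∈-upTo⁺)
import Data.List.Relation.Unary.All as All
open import Data.List.Relation.Unary.All.Properties using (all⁺; all⁻; ¬All⇒Any¬)
open import Data.List.Relation.Unary.Any using (satisfied)
open import Data.List.Relation.Unary.Any.Properties using (any⁺; any⁻)
open import Data.Product using (Σ; ∃; ∃₂; _×_; _,_; proj₁; proj₂)
open import Data.Product.Properties using (≡-dec)
open import Data.Sum as Sum using (_⊎_; inj₁; inj₂; [_,_]′)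
open import Data.Empty using (⊥; ⊥-elim)
open import Function using (_∘_; id)
open import Function.Bundles using (Equivalence; mk⇔)
open import Induction.WellFounded using (Acc; acc)
open import Relation.Binary.Definitions using (DecidableEquality; tri<; tri≈; tri>)
open import Relation.Binary.PropositionalEquality
open import Relation.Nullary using (Dec; yes; no; ¬_; does; ¬?; _×-dec_; contradiction)
open import Relation.Nullary.Decidable using (⌊_⌋; toWitness; fromWitness; T?)
open import Algebra.Properties.CommutativeMonoid.Sum +-0-commutativeMonoid
  using (sum-syntax; sum-cong-≗; ∑-distrib-+; sum-remove; sum-replicate-zero)
  renaming (sum to ∑)
open import Defs hiding (sym)


-- Booleans, finite sums and counting

T⇒≡true : {b : Bool} → T b → b ≡ true
T⇒≡true = Equivalence.to T-≡

≡true⇒T : {b : Bool} → b ≡ true → T b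
≡true⇒T = Equivalence.from T-≡

∧-true : ∀ {b c} → b ∧ c ≡ true → b ≡ true × c ≡ true
∧-true {true} c≡true = refl , c≡true

∨-true : ∀ {b c} → b ∨ c ≡ true → b ≡ true ⊎ c ≡ true
∨-true {true} _ = inj₁ refl
∨-true {false} c≡true = inj₂ c≡true

∨-true⁺ : ∀ {b c} → b ≡ true ⊎ c ≡ true → b ∨ c ≡ true
∨-true⁺ (inj₁ refl) = refl
∨-true⁺ {true} (inj₂ _) = refl
∨-true⁺ {false} (inj₂ c≡true) = c≡true

bool-ext : ∀ {b c} → (b ≡ true → c ≡ true) → (c ≡ true → b ≡ true) → b ≡ c
bool-ext to from = ⇔→≡ (mk⇔ to from)

𝟙 : Bool → ℕ
𝟙 b = if b then 1 else 0

𝟙-∨ : ∀ a b r → (a ≡ true → b ≡ true → ⊥) → 𝟙 ((a ∨ b) ∧ r) ≡ 𝟙 (a ∧ r) + 𝟙 (b ∧ r)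
𝟙-∨ true true r exclusive = ⊥-elim (exclusive refl refl)
𝟙-∨ true false r exclusive = sym (+-identityʳ _)
𝟙-∨ false b r exclusive = refl

module _ {n : ℕ} where

  ⁅_⁆ : Fin n → Fin n → Bool
  ⁅ e ⁆ x = does (x ≟ e)

  _∪⁅_⁆ : (Fin n → Bool) → Fin n → Fin n → Bool
  (p ∪⁅ e ⁆) x = p x ∨ ⁅ e ⁆ x

  ⁅⁆-self : (e : Fin n) → ⁅ e ⁆ e ≡ true
  ⁅⁆-self e with e ≟ e
  ... | yes _ = refl
  ... | no e≢e = ⊥-elim (e≢e refl)

  ⁅⁆-other : {e x : Fin n} → ¬ x ≡ e → ⁅ e ⁆ x ≡ false
  ⁅⁆-other {e} {x} x≢e with x ≟ e
  ... | yes x≡e = ⊥-elim (x≢e x≡e)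
  ... | no _ = refl

  ⁅⁆-sound : {e x : Fin n} → ⁅ e ⁆ x ≡ true → x ≡ e
  ⁅⁆-sound {e} {x} _ with x ≟ e
  ... | yes x≡e = x≡e

  ∪⁅⁆-other : (p : Fin n → Bool) {e x : Fin n} → ¬ x ≡ e → (p ∪⁅ e ⁆) x ≡ p x
  ∪⁅⁆-other p x≢e = trans (cong (p _ ∨_) (⁅⁆-other x≢e)) (∨-identityʳ _)

sum-allFin : {n : ℕ} (h : Fin n → ℕ) → sum (map h (allFin n)) ≡ ∑[ x < n ] h x
sum-allFin {n} h = trans (cong sum (map-tabulate id h)) (go h)
  where
  go : ∀ {m} (h : Fin m → ℕ) → sum (tabulate h) ≡ ∑ h
  go {zero} h = refl
  go {suc m} h = cong (λ s → h zero + s) (go (h ∘ suc))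

∑-zero : {n : ℕ} (h : Fin n → ℕ) → (∀ x → h x ≡ 0) → ∑ h ≡ 0
∑-zero {n} h h≡0 = trans (sum-cong-≗ h≡0) (sum-replicate-zero n)

∑-point : {n : ℕ} (h : Fin n → ℕ) (e : Fin n) → (∀ x → ¬ x ≡ e → h x ≡ 0) → ∑ h ≡ h e
∑-point {suc _} h e off =
  trans (sum-remove {i = e} h)
        (trans (cong (λ s → h e + s) (∑-zero _ (λ x → off _ (punchInᵢ≢i e x)))) (+-identityʳ (h e)))

module _ {n : ℕ} where

  sumOver : (Fin n → Bool) → (Fin n → ℕ) → ℕ
  sumOver p h = ∑[ x < n ] (if p x then h x else 0)

  sumOver-cong : {p q : Fin n → Bool} (h : Fin n → ℕ) → (∀ x → p x ≡ q x) → sumOver p h ≡ sumOver q h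
  sumOver-cong h p≗q = sum-cong-≗ (λ x → cong (λ b → if b then h x else 0) (p≗q x))

  sumOver-∪⁅⁆ : (p : Fin n → Bool) (h : Fin n → ℕ) {e : Fin n} → p e ≡ false →
                sumOver (p ∪⁅ e ⁆) h ≡ sumOver p h + h e
  sumOver-∪⁅⁆ p h {e} pe = begin
    sumOver (p ∪⁅ e ⁆) h                     ≡⟨ sum-cong-≗ split ⟩
    ∑[ x < n ] (on p x + on ⁅ e ⁆ x)         ≡⟨ ∑-distrib-+ (on p) (on ⁅ e ⁆) ⟩
    sumOver p h + sumOver ⁅ e ⁆ h            ≡⟨ cong (λ s → sumOver p h + s) (∑-point (on ⁅ e ⁆) e off) ⟩
    sumOver p h + on ⁅ e ⁆ e                 ≡⟨ cong (λ b → sumOver p h + (if b then h e else 0)) (⁅⁆-self e) ⟩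
    sumOver p h + h e                        ∎
    where
    open ≡-Reasoning
    on : (Fin n → Bool) → Fin n → ℕ
    on q x = if q x then h x else 0
    split : ∀ x → on (p ∪⁅ e ⁆) x ≡ on p x + on ⁅ e ⁆ x
    split x with x ≟ e
    ... | yes refl rewrite pe = refl
    ... | no _ rewrite ∨-identityʳ (p x) = sym (+-identityʳ _)
    off : ∀ x → ¬ x ≡ e → on ⁅ e ⁆ x ≡ 0
    off x x≢e rewrite ⁅⁆-other x≢e = refl

  count-∑ : (p : Fin n → Bool) → count p ≡ ∑[ x < n ] 𝟙 (p x)
  count-∑ p = sum-allFin (𝟙 ∘ p)

  count-cong : {p q : Fin n → Bool} → (∀ x → p x ≡ q x) → count p ≡ count q
  count-cong {p} {q} p≗q = trans (count-∑ p) (trans (sumOver-cong (λ _ → 1) p≗q) (sym (count-∑ q)))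

  count-∪⁅⁆ : (p : Fin n → Bool) {e : Fin n} → p e ≡ false → count (p ∪⁅ e ⁆) ≡ suc (count p)
  count-∪⁅⁆ p {e} pe = begin
    count (p ∪⁅ e ⁆)            ≡⟨ count-∑ (p ∪⁅ e ⁆) ⟩
    sumOver (p ∪⁅ e ⁆) (λ _ → 1) ≡⟨ sumOver-∪⁅⁆ p (λ _ → 1) pe ⟩
    sumOver p (λ _ → 1) + 1     ≡⟨ cong (_+ 1) (count-∑ p) ⟨
    count p + 1                 ≡⟨ +-comm (count p) 1 ⟩
    suc (count p)               ∎
    where open ≡-Reasoning

  count-+ : (p q r : Fin n → Bool) → (∀ x → 𝟙 (p x) ≡ 𝟙 (q x) + 𝟙 (r x)) →
            count p ≡ count q + count r
  count-+ p q r split = begin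
    count p                                  ≡⟨ count-∑ p ⟩
    ∑[ x < n ] 𝟙 (p x)                       ≡⟨ sum-cong-≗ split ⟩
    ∑[ x < n ] (𝟙 (q x) + 𝟙 (r x))           ≡⟨ ∑-distrib-+ (𝟙 ∘ q) (𝟙 ∘ r) ⟩
    ∑[ x < n ] 𝟙 (q x) + ∑[ x < n ] 𝟙 (r x)  ≡⟨ cong₂ _+_ (count-∑ q) (count-∑ r) ⟨
    count q + count r                        ∎
    where open ≡-Reasoning

  count-none : (p : Fin n → Bool) → (∀ x → p x ≡ false) → count p ≡ 0
  count-none p none = trans (count-∑ p) (∑-zero _ (λ x → cong 𝟙 (none x)))

  count-single : (p : Fin n → Bool) (e : Fin n) → p e ≡ true →
                 (∀ x → p x ≡ true → x ≡ e) → count p ≡ 1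
  count-single p e pe only-e = trans (count-∑ p) (trans (∑-point _ e off) (cong 𝟙 pe))
    where
    off : ∀ x → ¬ x ≡ e → 𝟙 (p x) ≡ 0
    off x x≢e with p x in px
    ... | true = ⊥-elim (x≢e (only-e x px))
    ... | false = refl

  count-⁅⁆ : (e : Fin n) → count ⁅ e ⁆ ≡ 1
  count-⁅⁆ e = count-single ⁅ e ⁆ e (⁅⁆-self e) (λ _ → ⁅⁆-sound)

  count-witness : (p : Fin n → Bool) → 1 ≤ count p → ∃ λ x → p x ≡ true
  count-witness p 1≤count with any? (λ x → p x ≟ᵇ true)
  ... | yes witness = witness
  ... | no none with subst (1 ≤_) (count-none p (λ x → ¬-not (λ px → none (x , px)))) 1≤count
  ... | ()

  count-witness-≢ : (p : Fin n → Bool) → 2 ≤ count p → (w : Fin n) →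
                    ∃ λ x → p x ≡ true × ¬ x ≡ w
  count-witness-≢ p 2≤count w with any? (λ x → (p x ≟ᵇ true) ×-dec ¬? (x ≟ w))
  ... | yes witness = witness
  ... | no none =
    contradiction (subst (2 ≤_) (trans (count-∑ p) (∑-point _ w off)) 2≤count) (2≰𝟙 (p w))
    where
    off : ∀ x → ¬ x ≡ w → 𝟙 (p x) ≡ 0
    off x x≢w with p x in px
    ... | true = ⊥-elim (none (x , px , x≢w))
    ... | false = refl
    2≰𝟙 : ∀ b → ¬ 2 ≤ 𝟙 b
    2≰𝟙 true (s≤s ())
    2≰𝟙 false ()

  grow-to-cover : (T : Fin n → Bool) (S : (Fin n → Bool) → Set) →
                  (∀ {K} v → T v ≡ true → K v ≡ false → S K → S (K ∪⁅ v ⁆)) →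
                  ∀ {K} → S K → ∃ λ K′ → S K′ × (∀ v → T v ≡ true → K′ v ≡ true)
  grow-to-cover T S extend {K} sK = go K sK (<-wellFounded _)
    where
    missing : (Fin n → Bool) → Fin n → Bool
    missing K w = T w ∧ not (K w)
    fewer : ∀ K v → T v ≡ true → K v ≡ false → count (missing K) ≡ suc (count (missing (K ∪⁅ v ⁆)))
    fewer K v Tv Kv = trans (count-cong pointwise) (count-∪⁅⁆ (missing (K ∪⁅ v ⁆)) v-done)
      where
      pointwise : ∀ w → missing K w ≡ (missing (K ∪⁅ v ⁆) ∪⁅ v ⁆) w
      pointwise w with w ≟ v
      ... | yes refl rewrite Tv | Kv = refl
      ... | no _ rewrite ∨-identityʳ (K w) = sym (∨-identityʳ _)
      v-done : missing (K ∪⁅ v ⁆) v ≡ false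
      v-done rewrite ⁅⁆-self v | ∨-zeroʳ (K v) = ∧-zeroʳ (T v)
    go : ∀ K → S K → Acc _<_ (count (missing K)) → ∃ λ K′ → S K′ × (∀ v → T v ≡ true → K′ v ≡ true)
    go K sK (acc smaller) with any? (λ v → (T v ≟ᵇ true) ×-dec (K v ≟ᵇ false))
    ... | yes (v , Tv , Kv) =
      go (K ∪⁅ v ⁆) (extend v Tv Kv sK) (smaller (≤-reflexive (sym (fewer K v Tv Kv))))
    ... | no none = K , sK , λ v Tv → ¬-not (λ Kv≡false → none (v , Tv , Kv≡false))

Darts : ℕ → Set
Darts n = Fin n × Fin n

_≟ᴰ_ : {n : ℕ} → DecidableEquality (Darts n)
_≟ᴰ_ = ≡-dec _≟_ _≟_

module _ {n : ℕ} where

  countD : (Darts n → Bool) → ℕ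
  countD p = ∑[ u < n ] count (λ v → p (u , v))

  countD-cong : {p q : Darts n → Bool} → (∀ d → p d ≡ q d) → countD p ≡ countD q
  countD-cong p≗q = sum-cong-≗ (λ u → count-cong (λ v → p≗q (u , v)))

  countD-+ : (p q r : Darts n → Bool) → (∀ d → 𝟙 (p d) ≡ 𝟙 (q d) + 𝟙 (r d)) →
             countD p ≡ countD q + countD r
  countD-+ p q r split =
    trans (sum-cong-≗ (λ u → count-+ _ _ _ (λ v → split (u , v))))
          (∑-distrib-+ (λ u → count (λ v → q (u , v))) (λ u → count (λ v → r (u , v))))

  countD-single : (p : Darts n → Bool) (e : Darts n) → p e ≡ true →
                  (∀ d → p d ≡ true → d ≡ e) → countD p ≡ 1
  countD-single p (eᵤ , eᵥ) pe only-e =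
    trans (∑-point _ eᵤ (λ u u≢eᵤ → count-none _ (λ v → off u v u≢eᵤ)))
          (count-single _ eᵥ pe (λ v pv → cong proj₂ (only-e _ pv)))
    where
    off : ∀ u v → ¬ u ≡ eᵤ → p (u , v) ≡ false
    off u v u≢eᵤ with p (u , v) in puv
    ... | true = ⊥-elim (u≢eᵤ (cong proj₁ (only-e _ puv)))
    ... | false = refl

  countD-insert : (p q : Darts n → Bool) (e : Darts n) → q e ≡ false → p e ≡ true →
                  (∀ d → ¬ d ≡ e → p d ≡ q d) → countD p ≡ suc (countD q)
  countD-insert p q e qe pe p≗q = begin
    countD p                         ≡⟨ countD-+ p q (λ d → ⌊ d ≟ᴰ e ⌋) split ⟩
    countD q + countD (λ d → ⌊ d ≟ᴰ e ⌋) ≡⟨ cong (λ k → countD q + k) (countD-single _ e e≟e only-e) ⟩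
    countD q + 1                     ≡⟨ +-comm (countD q) 1 ⟩
    suc (countD q)                   ∎
    where
    open ≡-Reasoning
    e≟e : ⌊ e ≟ᴰ e ⌋ ≡ true
    e≟e = T⇒≡true (fromWitness refl)
    only-e : ∀ d → ⌊ d ≟ᴰ e ⌋ ≡ true → d ≡ e
    only-e d d≟e = toWitness (≡true⇒T d≟e)
    split : ∀ d → 𝟙 (p d) ≡ 𝟙 (q d) + 𝟙 ⌊ d ≟ᴰ e ⌋
    split d with d ≟ᴰ e
    ... | yes refl rewrite qe | pe = refl
    ... | no d≢e = trans (cong 𝟙 (p≗q d d≢e)) (sym (+-identityʳ _))

-- Partial permutations: paths, insertion and exchange

module _ {A : Set} where

  data Path (f : A → A) : A → A → Set where
    here : ∀ {x} → Path f x x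
    step : ∀ {x y} → Path f (f x) y → Path f x y

  path-trans : ∀ {f : A → A} {x y z} → Path f x y → Path f y z → Path f x z
  path-trans here q = q
  path-trans (step p) q = step (path-trans p q)

  path-snoc : ∀ {f : A → A} {x y} → Path f x y → Path f x (f y)
  path-snoc p = path-trans p (step here)

  step-via : ∀ {f : A → A} {x y z} → f x ≡ y → Path f y z → Path f x z
  step-via refl p = step p

  iter-suc : ∀ (f : A → A) k x → iter f (suc k) x ≡ iter f k (f x)
  iter-suc f zero x = refl
  iter-suc f (suc k) x = cong f (iter-suc f k x)

  path→iter : ∀ {f : A → A} {x y} → Path f x y → ∃ λ k → iter f k x ≡ y
  path→iter here = 0 , refl
  path→iter {f} {x} (step p) with k , fᵏ⁺¹x≡y ← path→iter p = suc k , trans (iter-suc f k x) fᵏ⁺¹x≡y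

  iter→path : ∀ (f : A → A) k x → Path f x (iter f k x)
  iter→path f zero x = here
  iter→path f (suc k) x = path-snoc (iter→path f k x)

  iter-agree : ∀ (f g : A → A) x → (∀ k → g (iter f k x) ≡ f (iter f k x)) →
               ∀ k → iter g k x ≡ iter f k x
  iter-agree f g x agree zero = refl
  iter-agree f g x agree (suc k) = trans (cong g (iter-agree f g x agree k)) (agree k)

  record IsPermOn (P : A → Bool) (f : A → A) : Set where
    field
      preserves : ∀ x → P x ≡ true → P (f x) ≡ true
      injective : ∀ x y → P x ≡ true → P y ≡ true → f x ≡ f y → x ≡ y

  module _ {P : A → Bool} {f : A → A} (perm : IsPermOn P f) where
    open IsPermOn perm

    iter-preserves : ∀ k {x} → P x ≡ true → P (iter f k x) ≡ true
    iter-preserves zero Px = Px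
    iter-preserves (suc k) Px = preserves _ (iter-preserves k Px)

    path-preserves : ∀ {x y} → Path f x y → P x ≡ true → P y ≡ true
    path-preserves here Px = Px
    path-preserves (step p) Px = path-preserves p (preserves _ Px)

    path-cong-on : ∀ {g} → (∀ x → P x ≡ true → f x ≡ g x) → ∀ {x y} → P x ≡ true → Path f x y → Path g x y
    path-cong-on f≗g Px here = here
    path-cong-on f≗g Px (step p) = step-via (sym (f≗g _ Px)) (path-cong-on f≗g (preserves _ Px) p)

    path-sym : (∀ {x} → P x ≡ true → Path f (f x) x) → ∀ {x y} → P x ≡ true → Path f x y → Path f y x
    path-sym returns Px here = here
    path-sym returns Px (step p) = path-trans (path-sym returns (preserves _ Px) p) (returns Px)

module Rewiring {A : Set} (_≟_ : DecidableEquality A) where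

  data Position (a b w : A) : Set where
    at₁ : w ≡ a → Position a b w
    at₂ : w ≡ b → ¬ w ≡ a → Position a b w
    away : ¬ w ≡ a → ¬ w ≡ b → Position a b w

  position : ∀ a b w → Position a b w
  position a b w with w ≟ a
  ... | yes w≡a = at₁ w≡a
  ... | no w≢a with w ≟ b
  ...   | yes w≡b = at₂ w≡b w≢a
  ...   | no w≢b = away w≢a w≢b

  insertAfter : (A → A) → A → A → A → A
  insertAfter f a z w with w ≟ a
  ... | yes _ = z
  ... | no _ with w ≟ z
  ...   | yes _ = f a
  ...   | no _ = f w

  swapImages : (A → A) → A → A → A → A
  swapImages f a b w with w ≟ a
  ... | yes _ = f b
  ... | no _ with w ≟ b
  ...   | yes _ = f a
  ...   | no _ = f w

  module _ (f : A → A) (a z : A) where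

    insertAfter-at : insertAfter f a z a ≡ z
    insertAfter-at with a ≟ a
    ... | yes _ = refl
    ... | no a≢a = ⊥-elim (a≢a refl)

    insertAfter-new : ¬ z ≡ a → insertAfter f a z z ≡ f a
    insertAfter-new z≢a with z ≟ a
    ... | yes z≡a = ⊥-elim (z≢a z≡a)
    ... | no _ with z ≟ z
    ...   | yes _ = refl
    ...   | no z≢z = ⊥-elim (z≢z refl)

    insertAfter-away : ∀ {w} → ¬ w ≡ a → ¬ w ≡ z → insertAfter f a z w ≡ f w
    insertAfter-away {w} w≢a w≢z with w ≟ a
    ... | yes w≡a = ⊥-elim (w≢a w≡a)
    ... | no _ with w ≟ z
    ...   | yes w≡z = ⊥-elim (w≢z w≡z)
    ...   | no _ = refl

  module _ (f : A → A) (a b : A) where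

    swapImages-at₁ : swapImages f a b a ≡ f b
    swapImages-at₁ with a ≟ a
    ... | yes _ = refl
    ... | no a≢a = ⊥-elim (a≢a refl)

    swapImages-at₂ : ¬ a ≡ b → swapImages f a b b ≡ f a
    swapImages-at₂ a≢b with b ≟ a
    ... | yes b≡a = ⊥-elim (a≢b (sym b≡a))
    ... | no _ with b ≟ b
    ...   | yes _ = refl
    ...   | no b≢b = ⊥-elim (b≢b refl)

    swapImages-away : ∀ {w} → ¬ w ≡ a → ¬ w ≡ b → swapImages f a b w ≡ f w
    swapImages-away {w} w≢a w≢b with w ≟ a
    ... | yes w≡a = ⊥-elim (w≢a w≡a)
    ... | no _ with w ≟ b
    ...   | yes w≡b = ⊥-elim (w≢b w≡b)
    ...   | no _ = refl

  module InsertAfter {P P′ : A → Bool} {f : A → A} (perm : IsPermOn P f) {a z : A}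
                     (Pa : P a ≡ true) (Pz : P z ≡ false) (P′z : P′ z ≡ true)
                     (P⊆P′ : ∀ {x} → P x ≡ true → P′ x ≡ true)
                     (P′⊆ : ∀ {x} → P′ x ≡ true → P x ≡ true ⊎ x ≡ z) where
    open IsPermOn perm

    g : A → A
    g = insertAfter f a z

    P→≢z : ∀ {x} → P x ≡ true → ¬ x ≡ z
    P→≢z Px refl with () ← trans (sym Pz) Px

    z≢a : ¬ z ≡ a
    z≢a z≡a = P→≢z Pa (sym z≡a)

    P′→P : ∀ {x} → P′ x ≡ true → ¬ x ≡ z → P x ≡ true
    P′→P P′x x≢z with P′⊆ P′x
    ... | inj₁ Px = Px
    ... | inj₂ x≡z = ⊥-elim (x≢z x≡z)

    g-at : g a ≡ z
    g-at = insertAfter-at f a z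

    g-new : g z ≡ f a
    g-new = insertAfter-new f a z z≢a

    g-away : ∀ {x} → P x ≡ true → ¬ x ≡ a → g x ≡ f x
    g-away Px x≢a = insertAfter-away f a z x≢a (P→≢z Px)

    perm′ : IsPermOn P′ g
    perm′ = record { preserves = preserves′ ; injective = injective′ }
      where
      preserves′ : ∀ x → P′ x ≡ true → P′ (g x) ≡ true
      preserves′ x P′x with position a z x
      ... | at₁ refl rewrite g-at = P′z
      ... | at₂ refl _ rewrite g-new = P⊆P′ (preserves a Pa)
      ... | away x≢a x≢z rewrite g-away (P′→P P′x x≢z) x≢a = P⊆P′ (preserves x (P′→P P′x x≢z))
      injective′ : ∀ x y → P′ x ≡ true → P′ y ≡ true → g x ≡ g y → x ≡ y
      injective′ x y P′x P′y gx≡gy with position a z x | position a z y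
      ... | at₁ refl | at₁ refl = refl
      ... | at₂ refl _ | at₂ refl _ = refl
      ... | at₁ refl | at₂ refl _ =
        ⊥-elim (P→≢z (preserves a Pa) (sym (trans (sym g-at) (trans gx≡gy g-new))))
      ... | at₂ refl _ | at₁ refl =
        ⊥-elim (P→≢z (preserves a Pa) (trans (sym g-new) (trans gx≡gy g-at)))
      ... | at₁ refl | away y≢a y≢z =
        ⊥-elim (P→≢z (preserves y (P′→P P′y y≢z))
                     (sym (trans (sym g-at) (trans gx≡gy (g-away (P′→P P′y y≢z) y≢a)))))
      ... | away x≢a x≢z | at₁ refl =
        ⊥-elim (P→≢z (preserves x (P′→P P′x x≢z))
                     (trans (sym (g-away (P′→P P′x x≢z) x≢a)) (trans gx≡gy g-at)))
      ... | at₂ refl _ | away y≢a y≢z =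
        ⊥-elim (y≢a (sym (injective a y Pa (P′→P P′y y≢z)
                             (trans (sym g-new) (trans gx≡gy (g-away (P′→P P′y y≢z) y≢a))))))
      ... | away x≢a x≢z | at₂ refl _ =
        ⊥-elim (x≢a (injective x a (P′→P P′x x≢z) Pa
                         (trans (sym (g-away (P′→P P′x x≢z) x≢a)) (trans gx≡gy g-new))))
      ... | away x≢a x≢z | away y≢a y≢z =
        injective x y (P′→P P′x x≢z) (P′→P P′y y≢z)
          (trans (sym (g-away (P′→P P′x x≢z) x≢a)) (trans gx≡gy (g-away (P′→P P′y y≢z) y≢a)))

    g-step : ∀ {x} → P x ≡ true → Path g x (f x)
    g-step {x} Px with x ≟ a
    ... | yes refl = step-via g-at (step-via g-new here)
    ... | no x≢a = step-via (g-away Px x≢a) here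

    path-lift : ∀ {x y} → P x ≡ true → Path f x y → Path g x y
    path-lift Px here = here
    path-lift Px (step p) = path-trans (g-step Px) (path-lift (preserves _ Px) p)

    private
      lower : ∀ {w y} → P y ≡ true → Path g w y →
              (P w ≡ true → Path f w y) × (w ≡ z → Path f (f a) y)
      lower Py here = (λ _ → here) , (λ { refl → ⊥-elim (P→≢z Py refl) })
      lower {w} Py (step p) with from-w , from-z ← lower Py p | position a z w
      ... | at₁ refl = (λ _ → step (from-z g-at)) , (λ z≡a → ⊥-elim (z≢a (sym z≡a)))
      ... | at₂ refl _ = (λ Pz′ → ⊥-elim (P→≢z Pz′ refl)) ,
                         (λ _ → subst (λ u → Path f u _) g-new
                                  (from-w (subst (λ u → P u ≡ true) (sym g-new) (preserves a Pa))))
      ... | away w≢a w≢z = (λ Pw → step (subst (λ u → Path f u _) (g-away Pw w≢a)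
                                          (from-w (subst (λ u → P u ≡ true) (sym (g-away Pw w≢a))
                                                     (preserves w Pw))))) ,
                           (λ w≡z → ⊥-elim (w≢z w≡z))

    path-lower : ∀ {x y} → P x ≡ true → P y ≡ true → Path g x y → Path f x y
    path-lower Px Py p = proj₁ (lower Py p) Px

    orbit-within : ∀ {w x} → Path g w x → Path f a w ⊎ w ≡ z → Path f a x ⊎ x ≡ z
    orbit-within here w∈ = w∈
    orbit-within {w} (step p) w∈ = orbit-within p (next w∈)
      where
      next : Path f a w ⊎ w ≡ z → Path f a (g w) ⊎ g w ≡ z
      next w∈ with position a z w | w∈
      ... | at₁ refl | _ = inj₂ g-at
      ... | at₂ refl _ | _ = inj₁ (subst (Path f a) (sym g-new) (step here))
      ... | away w≢a w≢z | inj₁ a→w =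
        inj₁ (subst (Path f a) (sym (g-away (path-preserves perm a→w Pa) w≢a)) (path-snoc a→w))
      ... | away _ w≢z | inj₂ w≡z = ⊥-elim (w≢z w≡z)

    orbit-covered : ∀ {x} → Path f a x ⊎ x ≡ z → Path g a x
    orbit-covered (inj₁ a→x) = path-lift Pa a→x
    orbit-covered (inj₂ refl) = step-via g-at here

    cyclic-lift : (∀ {x y} → P x ≡ true → P y ≡ true → Path f x y) →
                  ∀ {x y} → P′ x ≡ true → P′ y ≡ true → Path g x y
    cyclic-lift cyc P′x P′y with P′⊆ P′x | P′⊆ P′y
    ... | inj₁ Px | inj₁ Py = path-lift Px (cyc Px Py)
    ... | inj₁ Px | inj₂ refl = path-trans (path-lift Px (cyc Px Pa)) (step-via g-at here)
    ... | inj₂ refl | inj₁ Py = step-via g-new (path-lift (preserves a Pa) (cyc (preserves a Pa) Py))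
    ... | inj₂ refl | inj₂ refl = here

  module SwapImages {P : A → Bool} {f : A → A} (perm : IsPermOn P f)
                    (returns : ∀ {x} → P x ≡ true → Path f (f x) x)
                    {a b : A} (Pa : P a ≡ true) (Pb : P b ≡ true) (a≢b : ¬ a ≡ b) where
    open IsPermOn perm

    g : A → A
    g = swapImages f a b

    g-at₁ : g a ≡ f b
    g-at₁ = swapImages-at₁ f a b

    g-at₂ : g b ≡ f a
    g-at₂ = swapImages-at₂ f a b a≢b

    g-away : ∀ {x} → ¬ x ≡ a → ¬ x ≡ b → g x ≡ f x
    g-away = swapImages-away f a b

    perm′ : IsPermOn P g
    perm′ = record { preserves = preserves′ ; injective = injective′ }
      where
      preserves′ : ∀ x → P x ≡ true → P (g x) ≡ true
      preserves′ x Px with position a b x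
      ... | at₁ refl rewrite g-at₁ = preserves b Pb
      ... | at₂ refl _ rewrite g-at₂ = preserves a Pa
      ... | away x≢a x≢b rewrite g-away x≢a x≢b = preserves x Px
      injective′ : ∀ x y → P x ≡ true → P y ≡ true → g x ≡ g y → x ≡ y
      injective′ x y Px Py gx≡gy with position a b x | position a b y
      ... | at₁ refl | at₁ refl = refl
      ... | at₂ refl _ | at₂ refl _ = refl
      ... | at₁ refl | at₂ refl _ =
        ⊥-elim (a≢b (sym (injective b a Pb Pa (trans (sym g-at₁) (trans gx≡gy g-at₂)))))
      ... | at₂ refl _ | at₁ refl =
        ⊥-elim (a≢b (injective a b Pa Pb (trans (sym g-at₂) (trans gx≡gy g-at₁))))
      ... | at₁ refl | away y≢a y≢b =
        ⊥-elim (y≢b (sym (injective b y Pb Py (trans (sym g-at₁) (trans gx≡gy (g-away y≢a y≢b))))))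
      ... | away x≢a x≢b | at₁ refl =
        ⊥-elim (x≢b (injective x b Px Pb (trans (sym (g-away x≢a x≢b)) (trans gx≡gy g-at₁))))
      ... | at₂ refl _ | away y≢a y≢b =
        ⊥-elim (y≢a (sym (injective a y Pa Py (trans (sym g-at₂) (trans gx≡gy (g-away y≢a y≢b))))))
      ... | away x≢a x≢b | at₂ refl _ =
        ⊥-elim (x≢a (injective x a Px Pa (trans (sym (g-away x≢a x≢b)) (trans gx≡gy g-at₂))))
      ... | away x≢a x≢b | away y≢a y≢b =
        injective x y Px Py (trans (sym (g-away x≢a x≢b)) (trans gx≡gy (g-away y≢a y≢b)))

    g-orbits-within : ∀ {w x} → Path g w x → Path f a w ⊎ Path f b w → Path f a x ⊎ Path f b x
    g-orbits-within here w∈ = w∈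
    g-orbits-within {w} (step p) w∈ = g-orbits-within p (next w∈)
      where
      next : Path f a w ⊎ Path f b w → Path f a (g w) ⊎ Path f b (g w)
      next w∈ with position a b w | w∈
      ... | at₁ refl | _ = inj₂ (step-via (sym g-at₁) here)
      ... | at₂ refl _ | _ = inj₁ (step-via (sym g-at₂) here)
      ... | away w≢a w≢b | inj₁ a→w = inj₁ (subst (Path f a) (sym (g-away w≢a w≢b)) (path-snoc a→w))
      ... | away w≢a w≢b | inj₂ b→w = inj₂ (subst (Path f b) (sym (g-away w≢a w≢b)) (path-snoc b→w))

    private
      next : ∀ {y} → Path g a y ⊎ Path g b y → Path g a (f y) ⊎ Path g b (f y)
      next {y} y∈ with position a b y | y∈
      ... | at₁ refl | _ = inj₂ (step-via g-at₂ here)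
      ... | at₂ refl _ | _ = inj₁ (step-via g-at₁ here)
      ... | away y≢a y≢b | inj₁ a→y = inj₁ (subst (Path g a) (g-away y≢a y≢b) (path-snoc a→y))
      ... | away y≢a y≢b | inj₂ b→y = inj₂ (subst (Path g b) (g-away y≢a y≢b) (path-snoc b→y))

      along : ∀ {s x} → Path g a s ⊎ Path g b s → Path f s x → Path g a x ⊎ Path g b x
      along s∈ here = s∈
      along s∈ (step p) = along (next s∈) p

    f-orbits-within : ∀ {x} → Path f a x ⊎ Path f b x → Path g a x ⊎ Path g b x
    f-orbits-within (inj₁ a→x) = along (inj₁ here) a→x
    f-orbits-within (inj₂ b→x) = along (inj₂ here) b→x

    join : ¬ Path f a b → Path g a b
    join a↛b = step-via g-at₁ (go (returns Pb))
      where
      go : ∀ {w} → Path f w b → Path g w b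
      go here = here
      go {w} (step p) with position a b w
      ... | at₁ refl = ⊥-elim (a↛b (step p))
      ... | at₂ refl _ = here
      ... | away w≢a w≢b = step-via (g-away w≢a w≢b) (go p)

    private
      data ReachesABeforeB : A → Set where
        at-a : ReachesABeforeB a
        next-a : ∀ {y} → ¬ y ≡ b → ReachesABeforeB (f y) → ReachesABeforeB y

      b-not-before : ¬ ReachesABeforeB b
      b-not-before at-a = a≢b refl
      b-not-before (next-a b≢b _) = b≢b refl

      last-b : ∀ {w} → Path f w a → ReachesABeforeB w ⊎ ReachesABeforeB (f b)
      last-b here = inj₁ at-a
      last-b {w} (step p) with last-b p
      ... | inj₂ fb-before = inj₂ fb-before
      ... | inj₁ fw-before with w ≟ b
      ...   | yes refl = inj₂ fw-before
      ...   | no w≢b = inj₁ (next-a w≢b fw-before)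

    separate : Path f a b → ¬ Path g a b
    separate a→b g-a→b = b-not-before (go g-a→b at-a)
      where
      fb-before : ReachesABeforeB (f b)
      fb-before with last-b (path-sym perm returns Pa a→b)
      ... | inj₁ b-before = ⊥-elim (b-not-before b-before)
      ... | inj₂ fb-before = fb-before
      g-before : ∀ {y} → ReachesABeforeB y → ReachesABeforeB (g y)
      g-before {y} y-before with position a b y
      ... | at₁ refl rewrite g-at₁ = fb-before
      ... | at₂ refl _ = ⊥-elim (b-not-before y-before)
      ... | away y≢a y≢b rewrite g-away y≢a y≢b with y-before
      ...   | at-a = ⊥-elim (y≢a refl)
      ...   | next-a _ fy-before = fy-before
      go : ∀ {y} → Path g y b → ReachesABeforeB y → ReachesABeforeB b
      go here y-before = y-before
      go (step p) y-before = go p (g-before y-before)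

-- Orbits of a permutation of darts

module _ {n : ℕ} where

  dartIndex : Darts n → Fin (n * n)
  dartIndex (u , v) = combine u v

  dartCode-index : ∀ d → dartCode d ≡ toℕ (dartIndex d)
  dartCode-index (u , v) = trans (cong (_+ toℕ v) (*-comm (toℕ u) n)) (sym (toℕ-combine u v))

  dartIndex-injective : ∀ {d e} → dartIndex d ≡ dartIndex e → d ≡ e
  dartIndex-injective {u , v} {u′ , v′} eq =
    cong₂ _,_ (combine-injectiveˡ u v u′ v′ eq) (combine-injectiveʳ u v u′ v′ eq)

  dartCode-injective : ∀ {d e} → dartCode d ≡ dartCode e → d ≡ e
  dartCode-injective {d} {e} eq =
    dartIndex-injective (toℕ-injective (trans (sym (dartCode-index d)) (trans eq (dartCode-index e))))

  module _ {P : Darts n → Bool} {f : Darts n → Darts n} (perm : IsPermOn P f) where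
    open IsPermOn perm

    private
      cancel : ∀ i d {x} → P x ≡ true → iter f i x ≡ iter f (i + d) x → x ≡ iter f d x
      cancel zero d Px eq = eq
      cancel (suc i) d Px eq =
        cancel i d Px (injective _ _ (iter-preserves perm i Px) (iter-preserves perm (i + d) Px) eq)

    period : ∀ {x} → P x ≡ true → ∃ λ p → 0 < p × p ≤ n * n × iter f p x ≡ x
    period {x} Px with i , j , i<j , eq ← pigeonhole (n<1+n (n * n)) (λ k → dartIndex (iter f (toℕ k) x)) =
      toℕ j ∸ toℕ i , m<n⇒0<n∸m i<j , ≤-trans (m∸n≤m (toℕ j) (toℕ i)) (≤-pred (toℕ<n j)) ,
      sym (cancel (toℕ i) _ Px (trans (dartIndex-injective eq)
                                      (cong (λ k → iter f k x) (sym (m+[n∸m]≡n (<⇒≤ i<j))))))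

    returns : ∀ {x} → P x ≡ true → Path f (f x) x
    returns {x} Px with suc p , _ , _ , fᵖx≡x ← period Px =
      subst (Path f (f x)) (trans (sym (iter-suc f p x)) fᵖx≡x) (iter→path f p (f x))

    private
      reduce-mod : ∀ {x p} → 0 < p → iter f p x ≡ x →
                   ∀ k → ∃ λ k′ → k′ < p × iter f k x ≡ iter f k′ x
      reduce-mod 0<p fᵖx≡x zero = 0 , 0<p , refl
      reduce-mod 0<p fᵖx≡x (suc k) with k′ , k′<p , eq ← reduce-mod 0<p fᵖx≡x k
        with m≤n⇒m<n∨m≡n k′<p
      ... | inj₁ k′+1<p = suc k′ , k′+1<p , cong f eq
      ... | inj₂ refl = 0 , 0<p , trans (cong f eq) fᵖx≡x

    iter-bounded : ∀ {x} → P x ≡ true → ∀ k → ∃ λ k′ → k′ < n * n × iter f k x ≡ iter f k′ x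
    iter-bounded Px k with p , 0<p , p≤M , fᵖx≡x ← period Px
      with k′ , k′<p , eq ← reduce-mod 0<p fᵖx≡x k = k′ , <-≤-trans k′<p p≤M , eq

    path-bounded : ∀ {x y} → P x ≡ true → Path f x y → ∃ λ k → k < n * n × iter f k x ≡ y
    path-bounded Px p with k , refl ← path→iter p with k′ , k′<M , eq ← iter-bounded Px k =
      k′ , k′<M , sym eq

  isRep : (Darts n → Darts n) → Darts n → Bool
  isRep f d = all (λ k → dartCode d ≤ᵇ dartCode (iter f k d)) (upTo (n * n))

  inOrbit : (Darts n → Darts n) → Darts n → Darts n → Bool
  inOrbit f x y = any (λ k → ⌊ iter f k x ≟ᴰ y ⌋) (upTo (n * n))

  inOrbit-sound : ∀ {f x y} → inOrbit f x y ≡ true → Path f x y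
  inOrbit-sound {f} {x} {y} x∼y with k , hit ← satisfied (any⁻ _ (upTo (n * n)) (≡true⇒T x∼y)) =
    subst (Path f x) (toWitness hit) (iter→path f k x)

  isRep-agree : ∀ {f g} x → (∀ k → g (iter f k x) ≡ f (iter f k x)) → isRep g x ≡ isRep f x
  isRep-agree {f} {g} x agree =
    cong and (map-cong (λ k → cong (λ y → dartCode x ≤ᵇ dartCode y) (iter-agree f g x agree k))
                       (upTo (n * n)))

  module _ {P : Darts n → Bool} {f : Darts n → Darts n} (perm : IsPermOn P f) where

    inOrbit-complete : ∀ {x y} → P x ≡ true → Path f x y → inOrbit f x y ≡ true
    inOrbit-complete Px p with k , k<M , refl ← path-bounded perm Px p =
      T⇒≡true (any⁺ _ (lose (∈-upTo⁺ k<M) (fromWitness refl)))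

    isRep-minimal : ∀ {x y} → P x ≡ true → isRep f x ≡ true → Path f x y → dartCode x ≤ dartCode y
    isRep-minimal Px rep p with k , k<M , refl ← path-bounded perm Px p =
      ≤ᵇ⇒≤ _ _ (All.lookup (all⁺ _ (upTo (n * n)) (≡true⇒T rep)) (∈-upTo⁺ k<M))

    isRep-unique : ∀ {x y} → P x ≡ true → isRep f x ≡ true → isRep f y ≡ true → Path f x y → x ≡ y
    isRep-unique Px rep-x rep-y p = dartCode-injective (≤-antisym
      (isRep-minimal Px rep-x p)
      (isRep-minimal (path-preserves perm p Px) rep-y (path-sym perm (returns perm) Px p)))

    isRep-exists : ∀ {x} → P x ≡ true → ∃ λ r → Path f x r × isRep f r ≡ true
    isRep-exists {x} = go x (<-wellFounded (dartCode x))
      where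
      go : ∀ x → Acc _<_ (dartCode x) → P x ≡ true → ∃ λ r → Path f x r × isRep f r ≡ true
      go x (acc smaller) Px with isRep f x in rep
      ... | true = x , here , rep
      ... | false
        with k , not-below ← satisfied (¬All⇒Any¬ (T? ∘ _) (upTo (n * n)) (λ all → subst T rep (all⁻ _ all)))
        with r , fᵏx→r , rep-r ← go (iter f k x) (smaller (≰⇒> (not-below ∘ ≤⇒≤ᵇ))) (iter-preserves perm k Px)
        = r , path-trans (iter→path f k x) fᵏx→r , rep-r

  orbits : (Darts n → Bool) → (Darts n → Darts n) → ℕ
  orbits P f = countD (λ d → P d ∧ isRep f d)

  orbitsIn : (W P : Darts n → Bool) → (Darts n → Darts n) → ℕ
  orbitsIn W P f = countD (λ d → W d ∧ (P d ∧ isRep f d))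

  -- Rewiring a permutation at a few darts only affects the orbits through them: the count is split into
  -- a window U containing those orbits, counted directly, and its complement, where representatives agree.
  orbits-split : ∀ P f (W : Darts n → Bool) → orbits P f ≡ orbitsIn (not ∘ W) P f + orbitsIn W P f
  orbits-split P f W = countD-+ _ _ _ (λ d → split (W d) (P d ∧ isRep f d))
    where
    split : ∀ w b → 𝟙 b ≡ 𝟙 (not w ∧ b) + 𝟙 (w ∧ b)
    split true b = refl
    split false b = sym (+-identityʳ _)

  orbitsIn-cong : ∀ {W W′ P f} → (∀ d → P d ≡ true → W d ≡ W′ d) → orbitsIn W P f ≡ orbitsIn W′ P f
  orbitsIn-cong {W} {W′} {P} {f} W≗W′ = countD-cong pointwise
    where
    pointwise : ∀ d → W d ∧ (P d ∧ isRep f d) ≡ W′ d ∧ (P d ∧ isRep f d)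
    pointwise d with P d in Pd
    ... | true = cong (_∧ isRep f d) (W≗W′ d Pd)
    ... | false = trans (∧-zeroʳ (W d)) (sym (∧-zeroʳ (W′ d)))

  orbitsIn-outside : ∀ {U P P′ f g} → (∀ d → U d ≡ false → P′ d ≡ P d) →
                     (∀ d → U d ≡ false → P d ≡ true → ∀ k → g (iter f k d) ≡ f (iter f k d)) →
                     orbitsIn (not ∘ U) P′ g ≡ orbitsIn (not ∘ U) P f
  orbitsIn-outside {U} {P} {P′} {f} {g} same-darts agree = countD-cong pointwise
    where
    pointwise : ∀ d → not (U d) ∧ (P′ d ∧ isRep g d) ≡ not (U d) ∧ (P d ∧ isRep f d)
    pointwise d with U d in Ud
    ... | true = refl
    ... | false rewrite same-darts d Ud with P d in Pd
    ...   | true = isRep-agree d (agree d Ud Pd)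
    ...   | false = refl

  module _ {P : Darts n → Bool} {f : Darts n → Darts n} (perm : IsPermOn P f) where

    orbitsIn-orbit : ∀ {a} → P a ≡ true → orbitsIn (inOrbit f a) P f ≡ 1
    orbitsIn-orbit {a} Pa with r , a→r , rep-r ← isRep-exists perm Pa =
      countD-single _ r
        (cong₂ _∧_ (inOrbit-complete perm Pa a→r) (cong₂ _∧_ (path-preserves perm a→r Pa) rep-r))
        only-r
      where
      only-r : ∀ x → inOrbit f a x ∧ (P x ∧ isRep f x) ≡ true → x ≡ r
      only-r x counted with a∼x , rest ← ∧-true counted with Px , rep-x ← ∧-true rest =
        isRep-unique perm Px rep-x rep-r
          (path-trans (path-sym perm (returns perm) Pa (inOrbit-sound a∼x)) a→r)

    orbitsIn-two-orbits : ∀ {a b} → P a ≡ true → P b ≡ true → ¬ Path f a b →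
                          orbitsIn (λ x → inOrbit f a x ∨ inOrbit f b x) P f ≡ 2
    orbitsIn-two-orbits {a} {b} Pa Pb a↛b =
      trans (countD-+ _ _ _ (λ x → 𝟙-∨ _ _ _ (disjoint x)))
            (cong₂ _+_ (orbitsIn-orbit Pa) (orbitsIn-orbit Pb))
      where
      disjoint : ∀ x → inOrbit f a x ≡ true → inOrbit f b x ≡ true → ⊥
      disjoint x a∼x b∼x =
        a↛b (path-trans (inOrbit-sound a∼x) (path-sym perm (returns perm) Pb (inOrbit-sound b∼x)))

  _∪ᴰ⁅_⁆ : (Darts n → Bool) → Darts n → Darts n → Bool
  (P ∪ᴰ⁅ z ⁆) x = P x ∨ ⌊ x ≟ᴰ z ⌋

  ∪ᴰ⁅⁆-new : (P : Darts n → Bool) (z : Darts n) → (P ∪ᴰ⁅ z ⁆) z ≡ true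
  ∪ᴰ⁅⁆-new P z = ∨-true⁺ (inj₂ (T⇒≡true (fromWitness {a? = z ≟ᴰ z} refl)))

  ∪ᴰ⁅⁆-old : (P : Darts n → Bool) {z x : Darts n} → ¬ x ≡ z → (P ∪ᴰ⁅ z ⁆) x ≡ P x
  ∪ᴰ⁅⁆-old P {z} {x} x≢z with x ≟ᴰ z
  ... | yes x≡z = ⊥-elim (x≢z x≡z)
  ... | no _ = ∨-identityʳ (P x)

  ∪ᴰ⁅⁆-cases : (P : Darts n → Bool) {z x : Darts n} → (P ∪ᴰ⁅ z ⁆) x ≡ true → P x ≡ true ⊎ x ≡ z
  ∪ᴰ⁅⁆-cases P {z} {x} P′x with ∨-true P′x
  ... | inj₁ Px = inj₁ Px
  ... | inj₂ x≡z = inj₂ (toWitness (≡true⇒T x≡z))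

  module _ {P : Darts n → Bool} {f : Darts n → Darts n} (perm : IsPermOn P f) where
    open IsPermOn perm
    open Rewiring (_≟ᴰ_ {n})

    module InsertDart {a z : Darts n} (Pa : P a ≡ true) (Pz : P z ≡ false) =
      InsertAfter perm Pa Pz (∪ᴰ⁅⁆-new P z) (λ Px → ∨-true⁺ (inj₁ Px)) (∪ᴰ⁅⁆-cases P)

    orbits-cong : ∀ {g} → (∀ x → P x ≡ true → f x ≡ g x) → orbits P g ≡ orbits P f
    orbits-cong {g} f≗g = countD-cong pointwise
      where
      pointwise : ∀ d → P d ∧ isRep g d ≡ P d ∧ isRep f d
      pointwise d with P d in Pd
      ... | true = isRep-agree d (λ k → sym (f≗g _ (iter-preserves perm k Pd)))
      ... | false = refl

    private
      outside-orbit : ∀ {a x} → P a ≡ true → inOrbit f a x ≡ false → P x ≡ true → ∀ k → ¬ iter f k x ≡ a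
      outside-orbit {a} {x} Pa x≁a Px k fᵏx≡a with () ← trans (sym x≁a)
        (inOrbit-complete perm Pa (path-sym perm (returns perm) Px (subst (Path f x) fᵏx≡a (iter→path f k x))))

    orbits-insertAfter : ∀ {a z} → P a ≡ true → P z ≡ false →
                         orbits (P ∪ᴰ⁅ z ⁆) (insertAfter f a z) ≡ orbits P f
    orbits-insertAfter {a} {z} Pa Pz = begin
      orbits P′ g                                ≡⟨ orbits-split P′ g U ⟩
      orbitsIn (not ∘ U) P′ g + orbitsIn U P′ g  ≡⟨ cong₂ _+_ outside (trans inside-g (sym inside-f)) ⟩
      orbitsIn (not ∘ U) P f + orbitsIn U P f    ≡⟨ orbits-split P f U ⟨
      orbits P f                                 ∎
      where
      open ≡-Reasoning
      P′ : Darts n → Bool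
      P′ = P ∪ᴰ⁅ z ⁆
      module I = InsertDart Pa Pz
      g : Darts n → Darts n
      g = I.g
      U : Darts n → Bool
      U = inOrbit f a ∪ᴰ⁅ z ⁆
      U-sound : ∀ {x} → U x ≡ true → Path f a x ⊎ x ≡ z
      U-sound Ux = Sum.map₁ inOrbit-sound (∪ᴰ⁅⁆-cases (inOrbit f a) Ux)
      U-complete : ∀ {x} → Path f a x ⊎ x ≡ z → U x ≡ true
      U-complete (inj₁ a→x) = ∨-true⁺ (inj₁ (inOrbit-complete perm Pa a→x))
      U-complete (inj₂ refl) = ∪ᴰ⁅⁆-new (inOrbit f a) z
      inside-f : orbitsIn U P f ≡ 1
      inside-f = trans (orbitsIn-cong (λ x Px → ∪ᴰ⁅⁆-old (inOrbit f a) (I.P→≢z Px))) (orbitsIn-orbit perm Pa)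
      inside-g : orbitsIn U P′ g ≡ 1
      inside-g = trans (orbitsIn-cong (λ x _ → bool-ext
                         (λ Ux → inOrbit-complete I.perm′ P′a (I.orbit-covered (U-sound Ux)))
                         (λ a∼x → U-complete (I.orbit-within (inOrbit-sound a∼x) (inj₁ here)))))
                       (orbitsIn-orbit I.perm′ P′a)
        where
        P′a : P′ a ≡ true
        P′a = ∨-true⁺ (inj₁ Pa)
      outside : orbitsIn (not ∘ U) P′ g ≡ orbitsIn (not ∘ U) P f
      outside = orbitsIn-outside
        (λ x Ux → ∪ᴰ⁅⁆-old P (λ x≡z → not-¬ Ux (U-complete (inj₂ x≡z))))
        (λ x Ux Px k → I.g-away (iter-preserves perm k Px)
                         (outside-orbit Pa (∨-conicalˡ _ _ Ux) Px k))

    private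
      inOrbit₂-sound : ∀ {g a b x} → (inOrbit g a x ∨ inOrbit g b x) ≡ true → Path g a x ⊎ Path g b x
      inOrbit₂-sound U with ∨-true U
      ... | inj₁ a∼x = inj₁ (inOrbit-sound a∼x)
      ... | inj₂ b∼x = inj₂ (inOrbit-sound b∼x)

      inOrbit₂-complete : ∀ {P′ g} → IsPermOn P′ g → ∀ {a b x} → P′ a ≡ true → P′ b ≡ true →
                          Path g a x ⊎ Path g b x → (inOrbit g a x ∨ inOrbit g b x) ≡ true
      inOrbit₂-complete perm′ P′a P′b (inj₁ a→x) = ∨-true⁺ (inj₁ (inOrbit-complete perm′ P′a a→x))
      inOrbit₂-complete perm′ P′a P′b (inj₂ b→x) = ∨-true⁺ (inj₂ (inOrbit-complete perm′ P′b b→x))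

    module _ {a b} (Pa : P a ≡ true) (Pb : P b ≡ true) (a≢b : ¬ a ≡ b) where
      private
        module S = SwapImages perm (returns perm) Pa Pb a≢b
        g : Darts n → Darts n
        g = S.g
        U : Darts n → Bool
        U x = inOrbit f a x ∨ inOrbit f b x
        outside : orbitsIn (not ∘ U) P g ≡ orbitsIn (not ∘ U) P f
        outside = orbitsIn-outside (λ _ _ → refl) (λ x Ux Px k →
          S.g-away (outside-orbit Pa (∨-conicalˡ _ _ Ux) Px k) (outside-orbit Pb (∨-conicalʳ _ _ Ux) Px k))
        g-window : ∀ {x} → Path g a x ⊎ Path g b x → Path f a x ⊎ Path f b x
        g-window (inj₁ a→x) = S.g-orbits-within a→x (inj₁ here)
        g-window (inj₂ b→x) = S.g-orbits-within b→x (inj₂ here)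
        O : ℕ
        O = orbitsIn (not ∘ U) P f

      swapImages-perm : IsPermOn P (swapImages f a b)
      swapImages-perm = S.perm′

      swapImages-separates : Path f a b → ¬ Path (swapImages f a b) a b
      swapImages-separates = S.separate

      orbits-swapImages-split : Path f a b → orbits P (swapImages f a b) ≡ suc (orbits P f)
      orbits-swapImages-split a→b = begin
        orbits P g                               ≡⟨ orbits-split P g U ⟩
        orbitsIn (not ∘ U) P g + orbitsIn U P g  ≡⟨ cong₂ _+_ outside inside-g ⟩
        O + 2                                    ≡⟨ +-suc O 1 ⟩
        suc (O + 1)                              ≡⟨ cong (λ k → suc (O + k)) inside-f ⟨
        suc (O + orbitsIn U P f)                 ≡⟨ cong suc (orbits-split P f U) ⟨
        suc (orbits P f)                         ∎
        where
        open ≡-Reasoning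
        inside-f : orbitsIn U P f ≡ 1
        inside-f = trans (orbitsIn-cong (λ x _ → bool-ext
                           (λ Ux → inOrbit-complete perm Pa ([ id , path-trans a→b ]′ (inOrbit₂-sound Ux)))
                           (λ a∼x → ∨-true⁺ (inj₁ a∼x))))
                         (orbitsIn-orbit perm Pa)
        inside-g : orbitsIn U P g ≡ 2
        inside-g = trans (orbitsIn-cong (λ x _ → bool-ext
                           (λ Ux → inOrbit₂-complete S.perm′ Pa Pb (S.f-orbits-within (inOrbit₂-sound Ux)))
                           (λ g∼x → inOrbit₂-complete perm Pa Pb (g-window (inOrbit₂-sound g∼x)))))
                         (orbitsIn-two-orbits S.perm′ Pa Pb (S.separate a→b))

      orbits-swapImages-merge : ¬ Path f a b → suc (orbits P (swapImages f a b)) ≡ orbits P f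
      orbits-swapImages-merge a↛b = begin
        suc (orbits P g)                         ≡⟨ cong suc (orbits-split P g U) ⟩
        suc (orbitsIn (not ∘ U) P g + orbitsIn U P g)  ≡⟨ cong suc (cong₂ _+_ outside inside-g) ⟩
        suc (O + 1)                              ≡⟨ +-suc O 1 ⟨
        O + 2                                    ≡⟨ cong (λ k → O + k) inside-f ⟨
        O + orbitsIn U P f                       ≡⟨ orbits-split P f U ⟨
        orbits P f                               ∎
        where
        open ≡-Reasoning
        inside-f : orbitsIn U P f ≡ 2
        inside-f = orbitsIn-two-orbits perm Pa Pb a↛b
        inside-g : orbitsIn U P g ≡ 1
        inside-g = trans (orbitsIn-cong (λ x _ → bool-ext
                           (λ Ux → inOrbit-complete S.perm′ Pa
                                     ([ id , path-trans (S.join a↛b) ]′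
                                        (S.f-orbits-within (inOrbit₂-sound Ux))))
                           (λ g∼x → inOrbit₂-complete perm Pa Pb (g-window (inj₁ (inOrbit-sound g∼x))))))
                         (orbitsIn-orbit S.perm′ Pa)

  orbits-darts-cong : ∀ {P Q f} → (∀ d → P d ≡ Q d) → orbits P f ≡ orbits Q f
  orbits-darts-cong {f = f} P≗Q = countD-cong (λ d → cong (_∧ isRep f d) (P≗Q d))

  path? : ∀ {P f} → IsPermOn P f → ∀ {x} → P x ≡ true → ∀ y → Dec (Path f x y)
  path? {f = f} perm {x} Px y with inOrbit f x y in x∼y
  ... | true = yes (inOrbit-sound x∼y)
  ... | false = no (λ x→y → not-¬ x∼y (inOrbit-complete perm Px x→y))

-- Rotation systems and adding an edge

Symmetric : {n : ℕ} → Adj n → Set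
Symmetric a = ∀ p q → a p q ≡ a q p

module _ {n : ℕ} where
  open Rewiring (_≟_ {n})
  private module Dartwise = Rewiring (_≟ᴰ_ {n})

  record IsCyclicOn (N : Fin n → Bool) (σ : Fin n → Fin n) : Set where
    field
      permutes : IsPermOn N σ
      connected : ∀ {w w′} → N w ≡ true → N w′ ≡ true → Path σ w w′
  open IsCyclicOn

  cyclic-cong : ∀ {N N′ σ} → (∀ w → N w ≡ N′ w) → IsCyclicOn N σ → IsCyclicOn N′ σ
  cyclic-cong {N} {N′} {σ} N≗N′ cyc = record
    { permutes = record
      { preserves = λ w N′w → trans (sym (N≗N′ _)) (IsPermOn.preserves (permutes cyc) w (to-N N′w))
      ; injective = λ w w′ N′w N′w′ → IsPermOn.injective (permutes cyc) w w′ (to-N N′w) (to-N N′w′)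
      }
    ; connected = λ N′w N′w′ → connected cyc (to-N N′w) (to-N N′w′)
    }
    where
    to-N : ∀ {w} → N′ w ≡ true → N w ≡ true
    to-N {w} = trans (N≗N′ w)

  rotation-cyclic : {a : Adj n} (R : Rotation a) (v : Fin n) → IsCyclicOn (a v) (ρ R v)
  rotation-cyclic R v = record
    { permutes = record { preserves = closed R v ; injective = inj R v }
    ; connected = λ {w} {w′} avw avw′ → let k , ρᵏw≡w′ = cyclic R v w w′ avw avw′
                                         in subst (Path _ w) ρᵏw≡w′ (iter→path _ k w)
    }

  mkRotation : {a : Adj n} (σ : Fin n → Fin n → Fin n) → (∀ v → IsCyclicOn (a v) (σ v)) → Rotation a
  mkRotation σ cyc = record
    { ρ = σ
    ; closed = λ v → IsPermOn.preserves (permutes (cyc v))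
    ; inj = λ v → IsPermOn.injective (permutes (cyc v))
    ; cyclic = λ v w w′ avw avw′ → path→iter (connected (cyc v) avw avw′)
    }

  insertAfter-cyclic : ∀ {N N′ σ x new} → IsCyclicOn N σ → N x ≡ true → N new ≡ false → N′ new ≡ true →
                       (∀ {w} → N w ≡ true → N′ w ≡ true) → (∀ {w} → N′ w ≡ true → N w ≡ true ⊎ w ≡ new) →
                       IsCyclicOn N′ (insertAfter σ x new)
  insertAfter-cyclic cyc Nx Nnew N′new N⊆N′ N′⊆ =
    record { permutes = I.perm′ ; connected = I.cyclic-lift (connected cyc) }
    where module I = InsertAfter (permutes cyc) Nx Nnew N′new N⊆N′ N′⊆

  constant-cyclic : ∀ {N u} → N u ≡ true → (∀ {w} → N w ≡ true → w ≡ u) → IsCyclicOn N (λ _ → u)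
  constant-cyclic Nu only-u = record
    { permutes = record
      { preserves = λ _ _ → Nu
      ; injective = λ w w′ Nw Nw′ _ → trans (only-u Nw) (sym (only-u Nw′))
      }
    ; connected = λ Nw Nw′ → subst₂ (Path _) (sym (only-u Nw)) (sym (only-u Nw′)) here
    }

  addEdge : Adj n → Fin n → Fin n → Adj n
  addEdge a u v p q = a p q ∨ (⁅ u ⁆ p ∧ ⁅ v ⁆ q ∨ ⁅ v ⁆ p ∧ ⁅ u ⁆ q)

  addEdge-comm : ∀ a u v p q → addEdge a u v p q ≡ addEdge a v u p q
  addEdge-comm a u v p q = cong (a p q ∨_) (∨-comm (⁅ u ⁆ p ∧ ⁅ v ⁆ q) _)

  addEdge-symmetric : ∀ {a} → Symmetric a → ∀ u v → Symmetric (addEdge a u v)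
  addEdge-symmetric {a} sym-a u v p q = cong₂ _∨_ (sym-a p q)
    (trans (∨-comm (⁅ u ⁆ p ∧ ⁅ v ⁆ q) _) (cong₂ _∨_ (∧-comm (⁅ v ⁆ p) _) (∧-comm (⁅ u ⁆ p) _)))

  module _ (a : Adj n) {u v : Fin n} (u≢v : ¬ u ≡ v) where

    addEdge-at₁ : ∀ w → addEdge a u v u w ≡ (a u ∪⁅ v ⁆) w
    addEdge-at₁ w rewrite ⁅⁆-self u | ⁅⁆-other u≢v = cong (a u w ∨_) (∨-identityʳ _)

    addEdge-at₂ : ∀ w → addEdge a u v v w ≡ (a v ∪⁅ u ⁆) w
    addEdge-at₂ w rewrite ⁅⁆-self v | ⁅⁆-other (u≢v ∘ sym) = refl

    addEdge-away : ∀ {p} q → ¬ p ≡ u → ¬ p ≡ v → addEdge a u v p q ≡ a p q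
    addEdge-away q p≢u p≢v rewrite ⁅⁆-other p≢u | ⁅⁆-other p≢v = ∨-identityʳ _

    addEdge-new : addEdge a u v u v ≡ true
    addEdge-new = trans (addEdge-at₁ v) (∨-true⁺ (inj₂ (⁅⁆-self v)))

    addEdge-new′ : addEdge a u v v u ≡ true
    addEdge-new′ = trans (addEdge-at₂ u) (∨-true⁺ (inj₂ (⁅⁆-self u)))

    addEdge-off-v : ∀ {p q} → ¬ p ≡ v → ¬ q ≡ v → addEdge a u v p q ≡ a p q
    addEdge-off-v {p} {q} p≢v q≢v rewrite ⁅⁆-other q≢v | ⁅⁆-other p≢v =
      trans (cong (λ b → a p q ∨ (b ∨ false)) (∧-zeroʳ (⁅ u ⁆ p))) (∨-identityʳ _)

    addEdge-at₁-cases : ∀ {w} → addEdge a u v u w ≡ true → a u w ≡ true ⊎ w ≡ v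
    addEdge-at₁-cases a′uw = Sum.map₂ ⁅⁆-sound (∨-true (trans (sym (addEdge-at₁ _)) a′uw))

    addEdge-at₂-cases : ∀ {w} → addEdge a u v v w ≡ true → a v w ≡ true ⊎ w ≡ u
    addEdge-at₂-cases a′vw = Sum.map₂ ⁅⁆-sound (∨-true (trans (sym (addEdge-at₂ _)) a′vw))

  module ExtendRotation {a : Adj n} (R : Rotation a) {u v : Fin n} (u≢v : ¬ u ≡ v)
                        {σu σv : Fin n → Fin n}
                        (cyc-u : IsCyclicOn (addEdge a u v u) σu)
                        (cyc-v : IsCyclicOn (addEdge a u v v) σv) where
    private
      select : ∀ {p} → Position u v p → Fin n → Fin n
      select (at₁ _) = σu
      select (at₂ _ _) = σv
      select {p} (away _ _) = ρ R p

      select-cyclic : ∀ {p} (pos : Position u v p) → IsCyclicOn (addEdge a u v p) (select pos)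
      select-cyclic (at₁ refl) = cyc-u
      select-cyclic (at₂ refl _) = cyc-v
      select-cyclic (away p≢u p≢v) =
        cyclic-cong (λ w → sym (addEdge-away a u≢v w p≢u p≢v)) (rotation-cyclic R _)

    R′ : Rotation (addEdge a u v)
    R′ = mkRotation (λ p → select (position u v p)) (λ p → select-cyclic (position u v p))

    ρ′-at₁ : ∀ w → ρ R′ u w ≡ σu w
    ρ′-at₁ w = go (position u v u)
      where
      go : (pos : Position u v u) → select pos w ≡ σu w
      go (at₁ _) = refl
      go (at₂ _ u≢u) = ⊥-elim (u≢u refl)
      go (away u≢u _) = ⊥-elim (u≢u refl)

    ρ′-at₂ : ∀ w → ρ R′ v w ≡ σv w
    ρ′-at₂ w = go (position u v v)
      where
      go : (pos : Position u v v) → select pos w ≡ σv w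
      go (at₁ v≡u) = ⊥-elim (u≢v (sym v≡u))
      go (at₂ _ _) = refl
      go (away _ v≢v) = ⊥-elim (v≢v refl)

    ρ′-away : ∀ {p} w → ¬ p ≡ u → ¬ p ≡ v → ρ R′ p w ≡ ρ R p w
    ρ′-away {p} w p≢u p≢v = go (position u v p)
      where
      go : (pos : Position u v p) → select pos w ≡ ρ R p w
      go (at₁ p≡u) = ⊥-elim (p≢u p≡u)
      go (at₂ p≡v _) = ⊥-elim (p≢v p≡v)
      go (away _ _) = refl

  dartsOf : Adj n → Darts n → Bool
  dartsOf a d = a (proj₁ d) (proj₂ d)

  numFaces-orbits : {a : Adj n} (R : Rotation a) → numFaces R ≡ orbits (dartsOf a) (facePerm R)
  numFaces-orbits {a} R = sum-allFin (λ u → count (λ v → a u v ∧ isFaceRep R (u , v)))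

  facePerm-perm : {a : Adj n} → Symmetric a → (R : Rotation a) → IsPermOn (dartsOf a) (facePerm R)
  facePerm-perm {a} sym-a R = record { preserves = preserves′ ; injective = injective′ }
    where
    preserves′ : ∀ d → dartsOf a d ≡ true → dartsOf a (facePerm R d) ≡ true
    preserves′ (p , q) apq = closed R q p (trans (sym-a q p) apq)
    injective′ : ∀ d e → dartsOf a d ≡ true → dartsOf a e ≡ true → facePerm R d ≡ facePerm R e → d ≡ e
    injective′ (p , q) (p′ , q′) apq ap′q′ eq with refl ← cong proj₁ eq =
      cong (_, q) (inj R q p p′ (trans (sym-a q p) apq) (trans (sym-a q p′) ap′q′) (cong proj₂ eq))

  module _ (a : Adj n) {u v : Fin n} (u≢v : ¬ u ≡ v) where

    addEdge-old-dart : ∀ d → ¬ d ≡ (u , v) → ¬ d ≡ (v , u) → dartsOf (addEdge a u v) d ≡ dartsOf a d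
    addEdge-old-dart (p , q) d≢uv d≢vu with position u v p
    ... | at₁ refl = trans (addEdge-at₁ a u≢v q) (∪⁅⁆-other (a u) (λ q≡v → d≢uv (cong (u ,_) q≡v)))
    ... | at₂ refl _ = trans (addEdge-at₂ a u≢v q) (∪⁅⁆-other (a v) (λ q≡u → d≢vu (cong (v ,_) q≡u)))
    ... | away p≢u p≢v = addEdge-away a u≢v q p≢u p≢v

    private
      A A₁ : Darts n → Bool
      A = dartsOf a
      A₁ = A ∪ᴰ⁅ (u , v) ⁆

    addEdge-darts : ∀ d → dartsOf (addEdge a u v) d ≡ ((dartsOf a ∪ᴰ⁅ (u , v) ⁆) ∪ᴰ⁅ (v , u) ⁆) d
    addEdge-darts d with Dartwise.position (u , v) (v , u) d
    ... | at₁ refl = trans (addEdge-new a u≢v)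
                           (sym (trans (∪ᴰ⁅⁆-old A₁ λ uv≡vu → u≢v (cong proj₁ uv≡vu)) (∪ᴰ⁅⁆-new A _)))
    ... | at₂ refl _ = trans (addEdge-new′ a u≢v) (sym (∪ᴰ⁅⁆-new A₁ _))
    ... | away d≢uv d≢vu = trans (addEdge-old-dart d d≢uv d≢vu)
                                 (sym (trans (∪ᴰ⁅⁆-old A₁ d≢vu) (∪ᴰ⁅⁆-old A d≢uv)))

  numEdges-countD : (a : Adj n) → numEdges a ≡ countD (λ d → (toℕ (proj₁ d) <ᵇ toℕ (proj₂ d)) ∧ dartsOf a d)
  numEdges-countD a = sum-allFin (λ u → count (λ v → (toℕ u <ᵇ toℕ v) ∧ a u v))

  numEdges-cong : {a b : Adj n} → (∀ p q → a p q ≡ b p q) → numEdges a ≡ numEdges b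
  numEdges-cong {a} {b} a≗b =
    trans (numEdges-countD a)
      (trans (countD-cong (λ d → cong ((toℕ (proj₁ d) <ᵇ toℕ (proj₂ d)) ∧_) (a≗b (proj₁ d) (proj₂ d))))
             (sym (numEdges-countD b)))

  private
    numEdges-addEdge-< : ∀ {a u v} → toℕ u < toℕ v → a u v ≡ false →
                         numEdges (addEdge a u v) ≡ suc (numEdges a)
    numEdges-addEdge-< {a} {u} {v} u<v auv = begin
      numEdges (addEdge a u v)                        ≡⟨ numEdges-countD (addEdge a u v) ⟩
      countD (λ d → lt d ∧ dartsOf (addEdge a u v) d) ≡⟨ countD-insert _ _ (u , v) q-uv p-uv p≗q ⟩
      suc (countD (λ d → lt d ∧ dartsOf a d))         ≡⟨ cong suc (numEdges-countD a) ⟨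
      suc (numEdges a)                                ∎
      where
      open ≡-Reasoning
      u≢v : ¬ u ≡ v
      u≢v refl = <-irrefl refl u<v
      lt : Darts n → Bool
      lt d = toℕ (proj₁ d) <ᵇ toℕ (proj₂ d)
      q-uv : lt (u , v) ∧ a u v ≡ false
      q-uv = trans (cong (lt (u , v) ∧_) auv) (∧-zeroʳ _)
      p-uv : lt (u , v) ∧ addEdge a u v u v ≡ true
      p-uv = cong₂ _∧_ (T⇒≡true (<⇒<ᵇ u<v)) (addEdge-new a u≢v)
      vu-false : lt (v , u) ≡ false
      vu-false = ¬-not (λ v<ᵇu → <-asym u<v (<ᵇ⇒< _ _ (≡true⇒T v<ᵇu)))
      p≗q : ∀ d → ¬ d ≡ (u , v) → lt d ∧ dartsOf (addEdge a u v) d ≡ lt d ∧ dartsOf a d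
      p≗q d d≢uv with d ≟ᴰ (v , u)
      ... | yes refl rewrite vu-false = refl
      ... | no d≢vu = cong (lt d ∧_) (addEdge-old-dart a u≢v d d≢uv d≢vu)

  numEdges-addEdge : ∀ {a u v} → Symmetric a → ¬ u ≡ v → a u v ≡ false →
                     numEdges (addEdge a u v) ≡ suc (numEdges a)
  numEdges-addEdge {a} {u} {v} sym-a u≢v auv with <-cmp (toℕ u) (toℕ v)
  ... | tri< u<v _ _ = numEdges-addEdge-< u<v auv
  ... | tri≈ _ u≡v _ = ⊥-elim (u≢v (toℕ-injective u≡v))
  ... | tri> _ _ v<u = trans (numEdges-cong (addEdge-comm a u v))
                             (numEdges-addEdge-< v<u (trans (sym-a v u) auv))

  module AddEdge {a : Adj n} (sym-a : Symmetric a) (R : Rotation a) {u v x : Fin n}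
                 (u≢v : ¬ u ≡ v) (a-uv : a u v ≡ false) (a-ux : a u x ≡ true) where

    φ : Darts n → Darts n
    φ = facePerm R

    φ-perm : IsPermOn (dartsOf a) φ
    φ-perm = facePerm-perm sym-a R

    d₁ d₂ c₁ : Darts n
    d₁ = (u , v)
    d₂ = (v , u)
    c₁ = (x , u)

    A A₁ A₂ : Darts n → Bool
    A = dartsOf a
    A₁ = A ∪ᴰ⁅ d₁ ⁆
    A₂ = A₁ ∪ᴰ⁅ d₂ ⁆

    x≢v : ¬ x ≡ v
    x≢v refl with () ← trans (sym a-uv) a-ux

    d₁≢d₂ : ¬ d₁ ≡ d₂
    d₁≢d₂ = u≢v ∘ cong proj₁

    c₁≢d₁ : ¬ c₁ ≡ d₁
    c₁≢d₁ = u≢v ∘ cong proj₂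

    c₁≢d₂ : ¬ c₁ ≡ d₂
    c₁≢d₂ = x≢v ∘ cong proj₁

    A-c₁ : A c₁ ≡ true
    A-c₁ = trans (sym-a x u) a-ux

    A⊆A₁ : ∀ {d} → A d ≡ true → A₁ d ≡ true
    A⊆A₁ Ad = ∨-true⁺ (inj₁ Ad)

    A₁-d₁ : A₁ d₁ ≡ true
    A₁-d₁ = ∪ᴰ⁅⁆-new A d₁

    A₁-d₂ : A₁ d₂ ≡ false
    A₁-d₂ = trans (∪ᴰ⁅⁆-old A (d₁≢d₂ ∘ sym)) (trans (sym-a v u) a-uv)

    A₂→A : ∀ {d} → A₂ d ≡ true → ¬ d ≡ d₁ → ¬ d ≡ d₂ → A d ≡ true
    A₂→A A₂d d≢d₁ d≢d₂ = trans (sym (∪ᴰ⁅⁆-old A d≢d₁)) (trans (sym (∪ᴰ⁅⁆-old A₁ d≢d₂)) A₂d)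

    module I₁ = InsertDart φ-perm A-c₁ a-uv

    cyc-u : IsCyclicOn (addEdge a u v u) (insertAfter (ρ R u) x v)
    cyc-u = insertAfter-cyclic (rotation-cyclic R u) a-ux a-uv (addEdge-new a u≢v)
              (λ auw → trans (addEdge-at₁ a u≢v _) (∨-true⁺ (inj₁ auw))) (addEdge-at₁-cases a u≢v)

    module WithRotationAtV {σv : Fin n → Fin n} (cyc-v : IsCyclicOn (addEdge a u v v) σv) where
      open ExtendRotation R u≢v cyc-u cyc-v public

      fp-c₁ : facePerm R′ c₁ ≡ d₁
      fp-c₁ = cong (u ,_) (trans (ρ′-at₁ x) (insertAfter-at (ρ R u) x v))

      fp-d₂ : facePerm R′ d₂ ≡ φ c₁
      fp-d₂ = cong (u ,_) (trans (ρ′-at₁ v) (insertAfter-new (ρ R u) x v (x≢v ∘ sym)))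

      fp-at-u : ∀ {p} → ¬ p ≡ x → ¬ p ≡ v → facePerm R′ (p , u) ≡ φ (p , u)
      fp-at-u {p} p≢x p≢v = cong (u ,_) (trans (ρ′-at₁ p) (insertAfter-away (ρ R u) x v p≢x p≢v))

      fp-away : ∀ {p q} → ¬ q ≡ u → ¬ q ≡ v → facePerm R′ (p , q) ≡ φ (p , q)
      fp-away {p} {q} q≢u q≢v = cong (q ,_) (ρ′-away p q≢u q≢v)

      numFaces-R′ : numFaces R′ ≡ orbits A₂ (facePerm R′)
      numFaces-R′ = trans (numFaces-orbits R′) (orbits-darts-cong (addEdge-darts a u≢v))

    -- With v isolated, the new face permutation is φ with d₁ and d₂ inserted after c₁: c₁ ↦ d₁ ↦ d₂ ↦ φ c₁.
    module Pendant (v-isolated : ∀ w → a v w ≡ false) where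

      private
        only-u : ∀ {w} → addEdge a u v v w ≡ true → w ≡ u
        only-u {w} a′vw with addEdge-at₂-cases a u≢v a′vw
        ... | inj₁ avw with () ← trans (sym (v-isolated w)) avw
        ... | inj₂ w≡u = w≡u

        module W = WithRotationAtV (constant-cyclic (addEdge-new′ a u≢v) only-u)
        module I₂ = InsertDart I₁.perm′ A₁-d₁ A₁-d₂

        agree : ∀ d → A₂ d ≡ true → I₂.g d ≡ facePerm W.R′ d
        agree d@(p , q) A₂d = go (d ≟ᴰ c₁) (d ≟ᴰ d₁) (d ≟ᴰ d₂)
          where
          go : Dec (d ≡ c₁) → Dec (d ≡ d₁) → Dec (d ≡ d₂) → I₂.g d ≡ facePerm W.R′ d
          go (yes refl) _ _ = trans (I₂.g-away (A⊆A₁ A-c₁) c₁≢d₁) (trans I₁.g-at (sym W.fp-c₁))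
          go (no _) (yes refl) _ = trans I₂.g-at (cong (v ,_) (sym (W.ρ′-at₂ u)))
          go (no _) (no _) (yes refl) = trans I₂.g-new (trans I₁.g-new (sym W.fp-d₂))
          go (no d≢c₁) (no d≢d₁) (no d≢d₂) =
            trans (I₂.g-away (A⊆A₁ Ad) d≢d₁) (trans (I₁.g-away Ad d≢c₁) (sym (old (position u v q))))
            where
            Ad : A d ≡ true
            Ad = A₂→A A₂d d≢d₁ d≢d₂
            old : Position u v q → facePerm W.R′ d ≡ φ d
            old (at₁ q≡u) = subst (λ q → facePerm W.R′ (p , q) ≡ φ (p , q)) (sym q≡u)
              (W.fp-at-u (λ p≡x → d≢c₁ (cong₂ _,_ p≡x q≡u)) (λ p≡v → d≢d₂ (cong₂ _,_ p≡v q≡u)))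
            old (at₂ q≡v _) with () ← trans (sym (v-isolated p))
                                         (trans (sym-a v p) (subst (λ q → a p q ≡ true) q≡v Ad))
            old (away q≢u q≢v) = W.fp-away q≢u q≢v

      R′ : Rotation (addEdge a u v)
      R′ = W.R′

      numFaces-pendant : numFaces R′ ≡ numFaces R
      numFaces-pendant = begin
        numFaces W.R′                ≡⟨ W.numFaces-R′ ⟩
        orbits A₂ (facePerm W.R′)    ≡⟨ orbits-cong I₂.perm′ agree ⟩
        orbits A₂ I₂.g               ≡⟨ orbits-insertAfter I₁.perm′ A₁-d₁ A₁-d₂ ⟩
        orbits A₁ I₁.g               ≡⟨ orbits-insertAfter φ-perm A-c₁ a-uv ⟩
        orbits A φ                   ≡⟨ numFaces-orbits R ⟨
        numFaces R                   ∎
        where open ≡-Reasoning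

    -- The new face permutation sends c₁ ↦ d₁ ↦ φ c₂ and c₂ ↦ d₂ ↦ φ c₁: it is φ with d₁, d₂ inserted
    -- after c₁, c₂ and then the images of d₁ and d₂ exchanged.
    module Bridge {y : Fin n} (a-vy : a v y ≡ true) where

      c₂ : Darts n
      c₂ = (y , v)

      private
        a-vu : a v u ≡ false
        a-vu = trans (sym-a v u) a-uv

        y≢u : ¬ y ≡ u
        y≢u refl with () ← trans (sym a-vu) a-vy

        c₂≢d₁ : ¬ c₂ ≡ d₁
        c₂≢d₁ = y≢u ∘ cong proj₁

        c₂≢d₂ : ¬ c₂ ≡ d₂
        c₂≢d₂ = u≢v ∘ sym ∘ cong proj₂

        c₁≢c₂ : ¬ c₁ ≡ c₂
        c₁≢c₂ = u≢v ∘ cong proj₂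

        A-c₂ : A c₂ ≡ true
        A-c₂ = trans (sym-a y v) a-vy

        cyc-v : IsCyclicOn (addEdge a u v v) (insertAfter (ρ R v) y u)
        cyc-v = insertAfter-cyclic (rotation-cyclic R v) a-vy a-vu (addEdge-new′ a u≢v)
                  (λ avw → trans (addEdge-at₂ a u≢v _) (∨-true⁺ (inj₁ avw))) (addEdge-at₂-cases a u≢v)

        module W = WithRotationAtV cyc-v
        module I₂ = InsertDart I₁.perm′ (A⊆A₁ A-c₂) A₁-d₂

        A⊆A₂ : ∀ {d} → A d ≡ true → A₂ d ≡ true
        A⊆A₂ Ad = ∨-true⁺ (inj₁ (A⊆A₁ Ad))

        A₂-d₁ : A₂ d₁ ≡ true
        A₂-d₁ = ∨-true⁺ (inj₁ A₁-d₁)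

        A₂-d₂ : A₂ d₂ ≡ true
        A₂-d₂ = ∪ᴰ⁅⁆-new A₁ d₂

        ψ₂ ψ₃ : Darts n → Darts n
        ψ₂ = I₂.g
        ψ₃ = Dartwise.swapImages ψ₂ d₁ d₂

        ψ₃-perm : IsPermOn A₂ ψ₃
        ψ₃-perm = swapImages-perm I₂.perm′ A₂-d₁ A₂-d₂ d₁≢d₂

        ψ₂-c₁ : ψ₂ c₁ ≡ d₁
        ψ₂-c₁ = trans (I₂.g-away (A⊆A₁ A-c₁) c₁≢c₂) I₁.g-at

        fp-at-v : ∀ {p} → ¬ p ≡ y → ¬ p ≡ u → facePerm W.R′ (p , v) ≡ φ (p , v)
        fp-at-v {p} p≢y p≢u = cong (v ,_) (trans (W.ρ′-at₂ p) (insertAfter-away (ρ R v) y u p≢y p≢u))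

        agree : ∀ d → A₂ d ≡ true → ψ₃ d ≡ facePerm W.R′ d
        agree d@(p , q) A₂d = go (d ≟ᴰ c₁) (d ≟ᴰ c₂) (d ≟ᴰ d₁) (d ≟ᴰ d₂)
          where
          go : Dec (d ≡ c₁) → Dec (d ≡ c₂) → Dec (d ≡ d₁) → Dec (d ≡ d₂) → ψ₃ d ≡ facePerm W.R′ d
          go (yes refl) _ _ _ =
            trans (Dartwise.swapImages-away ψ₂ d₁ d₂ c₁≢d₁ c₁≢d₂) (trans ψ₂-c₁ (sym W.fp-c₁))
          go (no _) (yes refl) _ _ =
            trans (Dartwise.swapImages-away ψ₂ d₁ d₂ c₂≢d₁ c₂≢d₂)
                  (trans I₂.g-at (cong (v ,_) (sym (trans (W.ρ′-at₂ y) (insertAfter-at (ρ R v) y u)))))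
          go (no _) (no _) (yes refl) _ =
            trans (Dartwise.swapImages-at₁ ψ₂ d₁ d₂)
                  (trans I₂.g-new (trans (I₁.g-away A-c₂ (c₁≢c₂ ∘ sym))
                    (cong (v ,_) (sym (trans (W.ρ′-at₂ u) (insertAfter-new (ρ R v) y u (y≢u ∘ sym)))))))
          go (no _) (no _) (no _) (yes refl) =
            trans (Dartwise.swapImages-at₂ ψ₂ d₁ d₂ d₁≢d₂)
                  (trans (I₂.g-away A₁-d₁ (c₂≢d₁ ∘ sym)) (trans I₁.g-new (sym W.fp-d₂)))
          go (no d≢c₁) (no d≢c₂) (no d≢d₁) (no d≢d₂) =
            trans (Dartwise.swapImages-away ψ₂ d₁ d₂ d≢d₁ d≢d₂)
                  (trans (I₂.g-away (A⊆A₁ Ad) d≢c₂)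
                         (trans (I₁.g-away Ad d≢c₁) (sym (old (position u v q)))))
            where
            Ad : A d ≡ true
            Ad = A₂→A A₂d d≢d₁ d≢d₂
            old : Position u v q → facePerm W.R′ d ≡ φ d
            old (at₁ q≡u) = subst (λ q → facePerm W.R′ (p , q) ≡ φ (p , q)) (sym q≡u)
              (W.fp-at-u (λ p≡x → d≢c₁ (cong₂ _,_ p≡x q≡u)) (λ p≡v → d≢d₂ (cong₂ _,_ p≡v q≡u)))
            old (at₂ q≡v _) = subst (λ q → facePerm W.R′ (p , q) ≡ φ (p , q)) (sym q≡v)
              (fp-at-v (λ p≡y → d≢c₂ (cong₂ _,_ p≡y q≡v)) (λ p≡u → d≢d₁ (cong₂ _,_ p≡u q≡v)))
            old (away q≢u q≢v) = W.fp-away q≢u q≢v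

        numFaces-ψ₃ : numFaces W.R′ ≡ orbits A₂ ψ₃
        numFaces-ψ₃ = trans W.numFaces-R′ (orbits-cong ψ₃-perm agree)

        numFaces-ψ₂ : orbits A₂ ψ₂ ≡ numFaces R
        numFaces-ψ₂ = trans (orbits-insertAfter I₁.perm′ (A⊆A₁ A-c₂) A₁-d₂)
                        (trans (orbits-insertAfter φ-perm A-c₁ a-uv) (sym (numFaces-orbits R)))

        back-to : ∀ {d e} → A₂ d ≡ true → ψ₂ d ≡ e → Path ψ₂ e d
        back-to A₂d ψ₂d≡e = path-sym I₂.perm′ (returns I₂.perm′) A₂d (step-via ψ₂d≡e here)

        corners→new : Path φ c₁ c₂ → Path ψ₂ d₁ d₂
        corners→new c₁→c₂ =
          path-trans (back-to (A⊆A₂ A-c₁) ψ₂-c₁)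
            (path-trans (I₂.path-lift (A⊆A₁ A-c₁) (I₁.path-lift A-c₁ c₁→c₂)) (step-via I₂.g-at here))

        new→corners : Path ψ₂ d₁ d₂ → Path φ c₁ c₂
        new→corners d₁→d₂ =
          I₁.path-lower A-c₁ A-c₂ (I₂.path-lower (A⊆A₁ A-c₁) (A⊆A₁ A-c₂)
            (step-via ψ₂-c₁ (path-trans d₁→d₂ (back-to (A⊆A₂ A-c₂) I₂.g-at))))

      R′ : Rotation (addEdge a u v)
      R′ = W.R′

      numFaces-split : Path φ c₁ c₂ → numFaces R′ ≡ suc (numFaces R)
      numFaces-split c₁→c₂ = trans numFaces-ψ₃
        (trans (orbits-swapImages-split I₂.perm′ A₂-d₁ A₂-d₂ d₁≢d₂ (corners→new c₁→c₂)) (cong suc numFaces-ψ₂))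

      numFaces-merge : ¬ Path φ c₁ c₂ → suc (numFaces R′) ≡ numFaces R
      numFaces-merge c₁↛c₂ = trans (cong suc numFaces-ψ₃)
        (trans (orbits-swapImages-merge I₂.perm′ A₂-d₁ A₂-d₂ d₁≢d₂ (c₁↛c₂ ∘ new→corners)) numFaces-ψ₂)

      split-separates : Path φ c₁ c₂ → ¬ Path (facePerm R′) c₂ d₁
      split-separates c₁→c₂ c₂→d₁ =
        swapImages-separates I₂.perm′ A₂-d₁ A₂-d₂ d₁≢d₂ (corners→new c₁→c₂)
          (path-trans (path-sym ψ₃-perm (returns ψ₃-perm) (A⊆A₂ A-c₂) ψ₃-c₂→d₁)
                      (step-via (trans (Dartwise.swapImages-away ψ₂ d₁ d₂ c₂≢d₁ c₂≢d₂) I₂.g-at) here))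
        where
        ψ₃-c₂→d₁ : Path ψ₃ c₂ d₁
        ψ₃-c₂→d₁ = path-cong-on (facePerm-perm (addEdge-symmetric sym-a u v) R′)
                     (λ d a′d → sym (agree d (trans (sym (addEdge-darts a u≢v d)) a′d)))
                     (trans (addEdge-symmetric sym-a u v y v)
                            (trans (addEdge-at₂ a u≢v y) (∨-true⁺ (inj₁ a-vy))))
                     c₂→d₁

  castRotation : {a b : Adj n} → (∀ p q → a p q ≡ b p q) → Rotation a → Rotation b
  castRotation a≗b R = mkRotation (ρ R) (λ v → cyclic-cong (a≗b v) (rotation-cyclic R v))

  twiceGenus-cast : ∀ {a b : Adj n} K (a≗b : ∀ p q → a p q ≡ b p q) (R : Rotation a) →
                    twiceGenus K (castRotation a≗b R) ≡ twiceGenus K R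
  twiceGenus-cast K a≗b R = cong₂ (λ E F → + 2 ℤ.- + count K ℤ.+ + E ℤ.- + F)
    (sym (numEdges-cong a≗b))
    (trans (numFaces-orbits (castRotation a≗b R))
      (trans (orbits-darts-cong (λ d → sym (a≗b (proj₁ d) (proj₂ d)))) (sym (numFaces-orbits R))))

  module _ {a a′ : Adj n} (R : Rotation a) (R′ : Rotation a′) (new-edge : numEdges a′ ≡ suc (numEdges a)) where

    twiceGenus-pendant : ∀ {K K′} → count K′ ≡ suc (count K) → numFaces R′ ≡ numFaces R →
                         twiceGenus K′ R′ ≡ twiceGenus K R
    twiceGenus-pendant {K} new-vertex same-faces rewrite new-vertex | new-edge | same-faces =
      euler (+ count K) (+ numEdges a) (+ numFaces R)
      where
      euler : ∀ V E F → + 2 ℤ.- (+ 1 ℤ.+ V) ℤ.+ (+ 1 ℤ.+ E) ℤ.- F ≡ + 2 ℤ.- V ℤ.+ E ℤ.- F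
      euler = solve-∀

    twiceGenus-split : ∀ K → numFaces R′ ≡ suc (numFaces R) → twiceGenus K R′ ≡ twiceGenus K R
    twiceGenus-split K new-face rewrite new-edge | new-face =
      euler (+ count K) (+ numEdges a) (+ numFaces R)
      where
      euler : ∀ V E F → + 2 ℤ.- V ℤ.+ (+ 1 ℤ.+ E) ℤ.- (+ 1 ℤ.+ F) ≡ + 2 ℤ.- V ℤ.+ E ℤ.- F
      euler = solve-∀

    twiceGenus-merge : ∀ K → suc (numFaces R′) ≡ numFaces R → twiceGenus K R′ ≡ + 2 ℤ.+ twiceGenus K R
    twiceGenus-merge K lost-face rewrite new-edge | sym lost-face =
      euler (+ count K) (+ numEdges a) (+ numFaces R′)
      where
      euler : ∀ V E F → + 2 ℤ.- V ℤ.+ (+ 1 ℤ.+ E) ℤ.- F ≡ + 2 ℤ.+ (+ 2 ℤ.- V ℤ.+ E ℤ.- (+ 1 ℤ.+ F))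
      euler = solve-∀

  twiceGenus-keep-cong : ∀ {a : Adj n} {K K′ : Fin n → Bool} → (∀ w → K w ≡ K′ w) → (R : Rotation a) →
                         twiceGenus K R ≡ twiceGenus K′ R
  twiceGenus-keep-cong {a} K≗K′ R = cong (λ c → + 2 ℤ.- + c ℤ.+ + numEdges a ℤ.- + numFaces R) (count-cong K≗K′)

-- Attaching the vertices of A

deg∸ε-bound : ∀ d s → d ≤ 1 + 2 * s ⊎ d ≡ 2 + 2 * s → d ∸ ε d ≤ 2 * s
deg∸ε-bound d s (inj₁ d≤1+2s) = ≤-trans (∸-monoʳ-≤ d (1≤ε d)) (∸-monoˡ-≤ 1 d≤1+2s)
  where
  1≤ε : ∀ d → 1 ≤ ε d
  1≤ε d with (d % 2) ≡ᵇ 1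
  ... | true = s≤s z≤n
  ... | false = s≤s z≤n
deg∸ε-bound _ s (inj₂ refl) = subst (λ e → (2 + 2 * s) ∸ e ≤ 2 * s) (sym ε-even) ≤-refl
  where
  ε-even : ε (2 + 2 * s) ≡ 2
  ε-even = cong (λ r → if r ≡ᵇ 1 then 1 else 2)
                (trans (cong (λ k → (2 + k) % 2) (*-comm 2 s)) ([m+kn]%n≡m%n 2 s 2))

module _ {n : ℕ} where

  induced-symmetric : ∀ {a : Adj n} → Symmetric a → ∀ K → Symmetric (induced a K)
  induced-symmetric {a} sym-a K p q with K p | K q
  ... | true | true = sym-a p q
  ... | true | false = refl
  ... | false | true = refl
  ... | false | false = refl

  induced-mono : ∀ {a : Adj n} {K K′} → (∀ w → K w ≡ true → K′ w ≡ true) →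
                 ∀ {p q} → induced a K p q ≡ true → induced a K′ p q ≡ true
  induced-mono K⊆K′ apq with Kp , rest ← ∧-true apq with Kq , a-pq ← ∧-true rest =
    cong₂ _∧_ (K⊆K′ _ Kp) (cong₂ _∧_ (K⊆K′ _ Kq) a-pq)

module Construction {n : ℕ} (G : Graph n) (inA : Fin n → Bool)
                    (deg≥3 : ∀ v → 3 ≤ deg (adj G) v)
                    (independent : ∀ u v → inA u ≡ true → inA v ≡ true → adj G u v ≡ false)
                    (H-connected : Connected (induced (adj G) (λ v → not (inA v))) (λ v → not (inA v)))
                    (R₀ : Rotation (induced (adj G) (λ v → not (inA v)))) where

  g : Adj n
  g = adj G

  inH : Fin n → Bool
  inH v = not (inA v)

  gain : Fin n → ℕ
  gain v = deg g v ∸ ε (deg g v)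

  record Stage (K : Fin n → Bool) : Set where
    field
      H⊆K : ∀ w → inH w ≡ true → K w ≡ true
      R : Rotation (induced g K)
      bound : + sumOver (λ w → inA w ∧ K w) gain ℤ.+ twiceGenus inH R₀ ℤ.≤ twiceGenus K R

  initial : Stage inH
  initial = record { H⊆K = λ _ Hw → Hw ; R = R₀ ; bound = ≤-initial }
    where
    nothing-gained : sumOver (λ w → inA w ∧ inH w) gain ≡ 0
    nothing-gained = ∑-zero _ (λ w → cong (λ b → if b then gain w else 0) (∧-inverseʳ (inA w)))
    ≤-initial : + sumOver (λ w → inA w ∧ inH w) gain ℤ.+ twiceGenus inH R₀ ℤ.≤ twiceGenus inH R₀
    ≤-initial rewrite nothing-gained = ℤ.≤-reflexive (ℤ.+-identityˡ _)

  neighbour-in-H : ∀ {v w} → inA v ≡ true → g v w ≡ true → inH w ≡ true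
  neighbour-in-H {v} {w} Av g-vw with inA w in Aw
  ... | false = refl
  ... | true with () ← trans (sym (independent v w Av Aw)) g-vw

  neighbour-≢ : ∀ {v w} → g v w ≡ true → ¬ w ≡ v
  neighbour-≢ {v} g-vw refl with () ← trans (sym (Graph.irrefl G v)) g-vw

  -- v has a second neighbour w₂ in H, and a walk from w to w₂ inside H starts with the wanted edge.
  corner-in-H : ∀ {v w} → inA v ≡ true → g v w ≡ true → ∃ λ x → induced g inH w x ≡ true
  corner-in-H {v} {w} Av g-vw
    with w₂ , g-vw₂ , w₂≢w ← count-witness-≢ (g v) (≤-trans (s≤s (s≤s z≤n)) (deg≥3 v)) w
    with proj₂ H-connected w w₂ (neighbour-in-H Av g-vw) (neighbour-in-H Av g-vw₂)
  ... | here = ⊥-elim (w₂≢w refl)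
  ... | step {w = x} H-wx _ = x , H-wx

  module Attach {K : Fin n → Bool} (S : Stage K) {v : Fin n} (Av : inA v ≡ true) (Kv : K v ≡ false) where
    open Stage S

    K′ : Fin n → Bool
    K′ = K ∪⁅ v ⁆

    a : Adj n
    a = induced g K

    a-symmetric : Symmetric a
    a-symmetric = induced-symmetric (Graph.sym G) K

    v-isolated : ∀ w → a v w ≡ false
    v-isolated w rewrite Kv = refl

    corner : ∀ {w} → g v w ≡ true → ∃ λ x → a w x ≡ true
    corner g-vw with x , H-wx ← corner-in-H Av g-vw = x , induced-mono {a = g} H⊆K H-wx

    SeparatedCorners : {b : Adj n} → (Fin n → Bool) → Rotation b → Set
    SeparatedCorners D Rb =
      ∃₂ λ y₁ y₂ → D y₁ ≡ true × D y₂ ≡ true × ¬ Path (facePerm Rb) (y₁ , v) (y₂ , v)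

    -- The balance invariant drives the greedy choice of the corner at v: with d = count D edges at v,
    -- s of them merges, either d ≤ 2s + 1, or d = 2s + 2 and two corners at v lie in different faces,
    -- so that the next edge can be made a merge whenever d = 2s + 2.
    record Partial (D : Fin n → Bool) : Set where
      field
        b : Adj n
        b-symmetric : Symmetric b
        Rb : Rotation b
        b-off-v : ∀ {p q} → ¬ p ≡ v → ¬ q ≡ v → b p q ≡ a p q
        b-at-v : ∀ q → b v q ≡ D q
        D⊆N : ∀ w → D w ≡ true → g v w ≡ true
        merges : ℕ
        genus : twiceGenus K′ Rb ≡ + (2 * merges) ℤ.+ twiceGenus K R
        y₀ : Fin n
        D-y₀ : D y₀ ≡ true
        balance : count D ≤ 1 + 2 * merges ⊎ (count D ≡ 2 + 2 * merges × SeparatedCorners D Rb)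

    first : ∃ λ w₀ → Partial ⁅ w₀ ⁆
    first with w₀ , g-vw₀ ← count-witness (g v) (≤-trans (s≤s z≤n) (deg≥3 v))
          with x , a-w₀x ← corner g-vw₀ = w₀ , record
      { b = addEdge a w₀ v
      ; b-symmetric = addEdge-symmetric a-symmetric w₀ v
      ; Rb = P.R′
      ; b-off-v = addEdge-off-v a w₀≢v
      ; b-at-v = λ q → trans (addEdge-at₂ a w₀≢v q) (cong (_∨ ⁅ w₀ ⁆ q) (v-isolated q))
      ; D⊆N = λ w w≡w₀ → subst (λ u → g v u ≡ true) (sym (⁅⁆-sound w≡w₀)) g-vw₀
      ; merges = 0
      ; genus = trans (twiceGenus-pendant R P.R′ (numEdges-addEdge a-symmetric w₀≢v a-w₀v)
                        (count-∪⁅⁆ K Kv) P.numFaces-pendant)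
                     (sym (ℤ.+-identityˡ _))
      ; y₀ = w₀
      ; D-y₀ = ⁅⁆-self w₀
      ; balance = inj₁ (≤-reflexive (count-⁅⁆ w₀))
      }
      where
      w₀≢v : ¬ w₀ ≡ v
      w₀≢v = neighbour-≢ g-vw₀
      a-w₀v : a w₀ v ≡ false
      a-w₀v = trans (a-symmetric w₀ v) (v-isolated w₀)
      module P = AddEdge.Pendant a-symmetric R w₀≢v a-w₀v a-w₀x v-isolated

    module Step {D : Fin n → Bool} (P : Partial D) {w : Fin n} (g-vw : g v w ≡ true) (Dw : D w ≡ false) where
      open Partial P

      w≢v : ¬ w ≡ v
      w≢v = neighbour-≢ g-vw

      b-wv : b w v ≡ false
      b-wv = trans (b-symmetric w v) (trans (b-at-v w) Dw)

      x : Fin n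
      x = proj₁ (corner g-vw)

      b-wx : b w x ≡ true
      b-wx = trans (b-off-v w≢v x≢v) (proj₂ (corner g-vw))
        where
        x≢v : ¬ x ≡ v
        x≢v x≡v with () ← trans (sym (trans (a-symmetric w v) (v-isolated w)))
                                (subst (λ u → a w u ≡ true) x≡v (proj₂ (corner g-vw)))

      module E = AddEdge b-symmetric Rb w≢v b-wv b-wx

      D′ : Fin n → Bool
      D′ = D ∪⁅ w ⁆

      one-more : count D′ ≡ suc (count D)
      one-more = count-∪⁅⁆ D Dw

      D⊆D′ : ∀ {y} → D y ≡ true → D′ y ≡ true
      D⊆D′ Dy = ∨-true⁺ (inj₁ Dy)

      new-edge : numEdges (addEdge b w v) ≡ suc (numEdges b)
      new-edge = numEdges-addEdge b-symmetric w≢v b-wv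

      joined : (R′ : Rotation (addEdge b w v)) (s : ℕ) → twiceGenus K′ R′ ≡ + (2 * s) ℤ.+ twiceGenus K R →
               count D′ ≤ 1 + 2 * s ⊎ (count D′ ≡ 2 + 2 * s × SeparatedCorners D′ R′) → Partial D′
      joined R′ s genus′ balance′ = record
        { b = addEdge b w v
        ; b-symmetric = addEdge-symmetric b-symmetric w v
        ; Rb = R′
        ; b-off-v = λ p≢v q≢v → trans (addEdge-off-v b w≢v p≢v q≢v) (b-off-v p≢v q≢v)
        ; b-at-v = λ q → trans (addEdge-at₂ b w≢v q) (cong (_∨ ⁅ w ⁆ q) (b-at-v q))
        ; D⊆N = λ u D′u → [ D⊆N u , (λ u≡w → subst (λ u → g v u ≡ true) (sym (⁅⁆-sound u≡w)) g-vw) ]′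
                            (∨-true D′u)
        ; merges = s
        ; genus = genus′
        ; y₀ = y₀
        ; D-y₀ = D⊆D′ D-y₀
        ; balance = balance′
        }

      merge-at : ∀ {y} → D y ≡ true → ¬ Path (facePerm Rb) (x , w) (y , v) → count D ≤ 2 + 2 * merges →
                 Partial D′
      merge-at {y} Dy c₁↛c₂ count≤ = joined B.R′ (suc merges) genus′ (inj₁ count′≤)
        where
        module B = E.Bridge (trans (b-at-v y) Dy)
        genus′ : twiceGenus K′ B.R′ ≡ + (2 * suc merges) ℤ.+ twiceGenus K R
        genus′ = begin
          twiceGenus K′ B.R′
            ≡⟨ twiceGenus-merge Rb B.R′ new-edge K′ (B.numFaces-merge c₁↛c₂) ⟩
          + 2 ℤ.+ twiceGenus K′ Rb                     ≡⟨ cong (λ t → + 2 ℤ.+ t) genus ⟩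
          + 2 ℤ.+ (+ (2 * merges) ℤ.+ twiceGenus K R)  ≡⟨ ℤ.+-assoc (+ 2) (+ (2 * merges)) (twiceGenus K R) ⟨
          + (2 + 2 * merges) ℤ.+ twiceGenus K R        ≡⟨ cong (λ k → + k ℤ.+ twiceGenus K R) (*-suc 2 merges) ⟨
          + (2 * suc merges) ℤ.+ twiceGenus K R        ∎
          where open ≡-Reasoning
        count′≤ : count D′ ≤ 1 + 2 * suc merges
        count′≤ = subst₂ _≤_ (sym one-more) (cong suc (sym (*-suc 2 merges))) (s≤s count≤)

      split-at : ∀ {y} → D y ≡ true → Path (facePerm Rb) (x , w) (y , v) → count D ≤ 1 + 2 * merges →
                 Partial D′
      split-at {y} Dy c₁→c₂ count≤ = joined B.R′ merges genus′ balance′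
        where
        module B = E.Bridge (trans (b-at-v y) Dy)
        genus′ : twiceGenus K′ B.R′ ≡ + (2 * merges) ℤ.+ twiceGenus K R
        genus′ = trans (twiceGenus-split Rb B.R′ new-edge K′ (B.numFaces-split c₁→c₂)) genus
        balance′ : count D′ ≤ 1 + 2 * merges ⊎ (count D′ ≡ 2 + 2 * merges × SeparatedCorners D′ B.R′)
        balance′ with m≤n⇒m<n∨m≡n (s≤s count≤)
        ... | inj₁ count′<2+2s = inj₁ (≤-pred (subst (λ c → suc c ≤ 2 + 2 * merges) (sym one-more) count′<2+2s))
        ... | inj₂ count′≡2+2s = inj₂ (trans one-more count′≡2+2s ,
                                       y , w , D⊆D′ Dy , ∨-true⁺ (inj₂ (⁅⁆-self w)) , B.split-separates c₁→c₂)

      -- Of two corners at v lying in different faces, at most one shares a face with the corner at w.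
      next : Partial D′
      next with balance
      ... | inj₂ (count≡ , y₁ , y₂ , Dy₁ , Dy₂ , y₁↛y₂) with path? E.φ-perm E.A-c₁ (y₁ , v)
      ...   | yes c₁→y₁ = merge-at Dy₂ (λ c₁→y₂ → y₁↛y₂ (path-trans y₁→c₁ c₁→y₂)) (≤-reflexive count≡)
        where
        y₁→c₁ : Path (facePerm Rb) (y₁ , v) (x , w)
        y₁→c₁ = path-sym E.φ-perm (returns E.φ-perm) E.A-c₁ c₁→y₁
      ...   | no c₁↛y₁ = merge-at Dy₁ c₁↛y₁ (≤-reflexive count≡)
      next | inj₁ count≤ with path? E.φ-perm E.A-c₁ (y₀ , v)
      ...   | yes c₁→y₀ = split-at D-y₀ c₁→y₀ count≤
      ...   | no c₁↛y₀ = merge-at D-y₀ c₁↛y₀ (≤-trans count≤ (n≤1+n _))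

    extend : ∀ {D} w → g v w ≡ true → D w ≡ false → Partial D → Partial (D ∪⁅ w ⁆)
    extend w g-vw Dw P = Step.next P g-vw Dw

    induced-at-v : ∀ q → induced g K′ v q ≡ g v q
    induced-at-v q rewrite ∨-true⁺ {K v} (inj₂ (⁅⁆-self v)) with g v q in g-vq
    ... | true = cong (_∧ true) (∨-true⁺ (inj₁ (H⊆K q (neighbour-in-H Av g-vq))))
    ... | false = ∧-zeroʳ _

    sumOver-K′ : sumOver (λ w → inA w ∧ K′ w) gain ≡ sumOver (λ w → inA w ∧ K w) gain + gain v
    sumOver-K′ = trans (sumOver-cong gain pointwise)
                       (sumOver-∪⁅⁆ _ gain (trans (cong (inA v ∧_) Kv) (∧-zeroʳ _)))
      where
      pointwise : ∀ w → inA w ∧ K′ w ≡ ((λ w → inA w ∧ K w) ∪⁅ v ⁆) w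
      pointwise w with w ≟ v
      ... | yes refl = trans (cong₂ _∧_ Av (∨-zeroʳ (K w))) (sym (∨-zeroʳ _))
      ... | no _ = trans (cong (inA w ∧_) (∨-identityʳ (K w))) (sym (∨-identityʳ _))

    finish : ∀ {D} → Partial D → (∀ w → g v w ≡ true → D w ≡ true) → Stage K′
    finish {D} P N⊆D = record
      { H⊆K = λ w Hw → ∨-true⁺ (inj₁ (H⊆K w Hw))
      ; R = castRotation b≗ Rb
      ; bound = begin
        + sumOver (λ w → inA w ∧ K′ w) gain ℤ.+ τ₀   ≡⟨ cong (λ s → + s ℤ.+ τ₀) sumOver-K′ ⟩
        + (S₀ + gain v) ℤ.+ τ₀                       ≡⟨ regroup (+ S₀) (+ gain v) τ₀ ⟩
        + gain v ℤ.+ (+ S₀ ℤ.+ τ₀)                   ≤⟨ ℤ.+-mono-≤ (+≤+ gain≤) bound ⟩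
        + (2 * merges) ℤ.+ twiceGenus K R            ≡⟨ genus ⟨
        twiceGenus K′ Rb                             ≡⟨ twiceGenus-cast K′ b≗ Rb ⟨
        twiceGenus K′ (castRotation b≗ Rb)           ∎
      }
      where
      open Partial P
      open ℤ.≤-Reasoning
      τ₀ : ℤ
      τ₀ = twiceGenus inH R₀
      S₀ : ℕ
      S₀ = sumOver (λ w → inA w ∧ K w) gain
      regroup : ∀ x y t → (x ℤ.+ y) ℤ.+ t ≡ y ℤ.+ (x ℤ.+ t)
      regroup = solve-∀

      D≗N : ∀ w → D w ≡ g v w
      D≗N w = bool-ext (D⊆N w) (N⊆D w)

      b≗ : ∀ p q → b p q ≡ induced g K′ p q
      b≗ p q = go (p ≟ v) (q ≟ v)
        where
        go : Dec (p ≡ v) → Dec (q ≡ v) → b p q ≡ induced g K′ p q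
        go (yes refl) _ = trans (b-at-v q) (trans (D≗N q) (sym (induced-at-v q)))
        go (no _) (yes refl) = trans (b-symmetric p v) (trans (b-at-v p) (trans (D≗N p)
                                 (sym (trans (induced-symmetric (Graph.sym G) K′ p v) (induced-at-v p)))))
        go (no p≢v) (no q≢v) = trans (b-off-v p≢v q≢v)
          (cong₂ (λ kp kq → kp ∧ kq ∧ g p q) (sym (∪⁅⁆-other K p≢v)) (sym (∪⁅⁆-other K q≢v)))

      gain≤ : gain v ≤ 2 * merges
      gain≤ = deg∸ε-bound (deg g v) merges degree-balance
        where
        degree-balance : deg g v ≤ 1 + 2 * merges ⊎ deg g v ≡ 2 + 2 * merges
        degree-balance with balance
        ... | inj₁ count≤ = inj₁ (subst (_≤ 1 + 2 * merges) (count-cong D≗N) count≤)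
        ... | inj₂ (count≡ , _) = inj₂ (trans (sym (count-cong D≗N)) count≡)

    attach : Stage K′
    attach = let _ , P , N⊆D = grow-to-cover (g v) Partial extend (proj₂ first) in finish P N⊆D

  complete : ∃ λ K → Stage K × (∀ v → inA v ≡ true → K v ≡ true)
  complete = grow-to-cover inA Stage (λ _ Av Kv S → Attach.attach S Av Kv) initial

  conclude : ∀ {K} → Stage K → (∀ v → inA v ≡ true → K v ≡ true) →
             Σ (Rotation g) λ R → twiceGenus allV R ℤ.≥ + sumTerm g inA ℤ.+ twiceGenus inH R₀
  conclude {K} S A⊆K = R-G , bound′
    where
    open Stage S
    K-all : ∀ w → K w ≡ true
    K-all w with inA w in Aw
    ... | true = A⊆K w Aw
    ... | false = H⊆K w (cong not Aw)
    full : ∀ p q → induced g K p q ≡ g p q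
    full p q rewrite K-all p | K-all q = refl
    R-G : Rotation g
    R-G = castRotation full R
    bound′ : + sumTerm g inA ℤ.+ twiceGenus inH R₀ ℤ.≤ twiceGenus allV R-G
    bound′ = begin
      + sumTerm g inA ℤ.+ τ₀                       ≡⟨ cong (λ s → + s ℤ.+ τ₀) gained ⟩
      + sumOver (λ w → inA w ∧ K w) gain ℤ.+ τ₀   ≤⟨ bound ⟩
      twiceGenus K R                               ≡⟨ twiceGenus-cast K full R ⟨
      twiceGenus K R-G                             ≡⟨ twiceGenus-keep-cong K-all R-G ⟩
      twiceGenus allV R-G                          ∎
      where
      open ℤ.≤-Reasoning
      τ₀ : ℤ
      τ₀ = twiceGenus inH R₀
      gained : sumTerm g inA ≡ sumOver (λ w → inA w ∧ K w) gain
      gained = trans (sum-allFin (λ w → if inA w then gain w else 0))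
                     (sumOver-cong gain (λ w → sym (trans (cong (inA w ∧_) (K-all w)) (∧-identityʳ _))))

  theorem : Σ (Rotation g) λ R → twiceGenus allV R ℤ.≥ + sumTerm g inA ℤ.+ twiceGenus inH R₀
  theorem = let _ , S , A⊆K = complete in conclude S A⊆K

theoremB : {n : ℕ} (G : Graph n) (inA : Fin n → Bool) →
  Connected (adj G) allV →
  (∀ v → 3 ≤ deg (adj G) v) →
  (∀ u v → inA u ≡ true → inA v ≡ true → adj G u v ≡ false) →
  Connected (induced (adj G) (λ v → not (inA v))) (λ v → not (inA v)) →
  (R′ : Rotation (induced (adj G) (λ v → not (inA v)))) →
  Σ (Rotation (adj G)) (λ R →
    twiceGenus allV R ℤ.≥
      + sumTerm (adj G) inA ℤ.+ twiceGenus (λ v → not (inA v)) R′)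
theoremB G inA _ deg≥3 independent H-connected R′ =
  Construction.theorem G inA deg≥3 independent H-connected R′
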